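{- Let $\Gamma$ be the class of finite, simple, undirected, connected, non-complete graphs. For $G\in\Gamma$ with vertex set $V$, $|V|=n$, edge set $E$ and minimum degree $\delta$, define: $\alpha_{CW}(G)=\sum_{u\in V}\frac{1}{d(u)+1}$; $\alpha_S(G)=\alpha_{CW}(G)+\sum_{u\in V}\frac{1}{d(u)+1}\max\left\{\frac{d(u)}{d(u)+1}-\sum_{v\in N(u)}\frac{1}{d(v)+1},\,0\right\}$; $\alpha_{ACL}(G)=\alpha_{CW}(G)+\frac{A(G)}{\alpha_{CW}(G)-1}$, where $A(G)=\sum_{u\in V}\frac{d(u)}{(d(u)+1)^2}-\sum_{\{u,v\}\in E}\frac{2}{(d(u)+1)(d(v)+1)}+\sum_{\{u,v\}\in\binom{V}{2}\setminus E}\frac{2|N(u)\cap N(v)|}{(d(u)+1)(d(v)+1)(2+d(u)+d(v)-|N(u)\cap N(v)|)}$; $\alpha_{HR}(G)$ is the smallest positive integer $k$ with $k\ge\phi(G,2(k-1))$, where for an integer $l\ge0$, $\phi(G,l)=\min\{\sum_{u\in V}\frac{1}{d(u)+1-\psi(u)}:\ \psi(u)\in\{0,1,\dots,d(u)\}\text{ for all }u,\ \sum_{u\in V}\psi(u)=l\}$; $\alpha_{HM}(G)=\max_{2\le t\le n-\delta}\left(2t-1-\frac{b(G,t)}{a(G,t)}\right)$ with $a(G,t)=\sum_{u\in V}\binom{n-d(u)-1}{t-1}$ and $b(G,t)=2\sum_{\{u,v\}\in\binom{V}{2}\setminus E}\left(\binom{n-d(u)-1}{t-2}+\binom{n-d(v)-1}{t-2}-\binom{n-|N[u]\cup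 N[v]|}{t-2}\right)$. Then: 1. The four functions $\alpha_{ACL},\alpha_S,\alpha_{HR},\alpha_{HM}$ are pairwise incomparable on $\Gamma$: for any two of them, $f$ and $g$, there exist $G_1,G_2\in\Gamma$ with $f(G_1)<g(G_1)$ and $g(G_2)<f(G_2)$. 2. There is a sequence $(G_m)$ of graphs in $\Gamma$ such that $\lim_{m\to\infty}\frac{\alpha_{HM}(G_m)}{\max\{\alpha_{ACL}(G_m),\alpha_{HR}(G_m),\alpha_S(G_m)\}}=\infty$.
   Context: For $u\in V$, $N(u)$ is the neighborhood, $d(u)=|N(u)|$, $N[u]=N(u)\cup\{u\}$. $\binom{V}{2}$ is the set of 2-element subsets of $V$. Binomial coefficients $\binom{m}{k}$ count $k$-element subsets of an $m$-element set, with $\binom{m}{k}=0$ if $k<0$ or $k>m$. For $G\in\Gamma$ one has $\alpha_{CW}(G)>1$, so $\alpha_{ACL}$ is well defined; $\phi(G,l)$ is defined for $0\le l\le 2|E|$, and $\alpha_{HR}(G)$ exists. -}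

module Defs where

open import Data.Bool using (Bool; true; false; _∧_; _∨_; if_then_else_)
open import Data.Nat as ℕ using (ℕ; zero; suc; _∸_; _<ᵇ_; _≡ᵇ_)
open import Data.Nat.Combinatorics using (_C_)
open import Data.Integer as ℤ using (ℤ; +_)
open import Data.Rational as ℚ using (ℚ; 0ℚ; 1ℚ; _/_; _÷_; _⊔_; _⊓_; _≤ᵇ_; ≢-nonZero)
open import Data.Rational.Properties using (_≟_)
open import Data.Fin as Fin using (Fin; toℕ)
open import Data.List using (List; []; _∷_; [_]; map; foldr; concatMap; upTo; allFin; zipWith)
open import Data.Nat.ListAction using (sum)
open import Data.Maybe using (Maybe; just; nothing)
open import Data.Product using (Σ; _×_; _,_)
open import Relation.Binary.PropositionalEquality using (_≡_; _≢_)
open import Relation.Nullary using (yes; no)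

record Graph (n : ℕ) : Set where
  field
    adj    : Fin n → Fin n → Bool
    sym    : ∀ u v → adj u v ≡ adj v u
    irrefl : ∀ u → adj u u ≡ false
open Graph public

data Walk {n : ℕ} (G : Graph n) : Fin n → Fin n → Set where
  nil  : ∀ {u} → Walk G u u
  cons : ∀ {u w v} → adj G u w ≡ true → Walk G w v → Walk G u v

Connected : ∀ {n} → Graph n → Set
Connected {n} G = ∀ (u v : Fin n) → Walk G u v

NonComplete : ∀ {n} → Graph n → Set
NonComplete {n} G = Σ (Fin n) λ u → Σ (Fin n) λ v → u ≢ v × adj G u v ≡ false

record ΓGraph : Set where
  field
    n           : ℕ
    graph       : Graph n
    connected   : Connected graph
    nonComplete : NonComplete graph
open ΓGraph public

count : List Bool → ℕ
count = foldr (λ b k → if b then suc k else k) 0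

sumQ : List ℚ → ℚ
sumQ = foldr ℚ._+_ 0ℚ

1/[1+_] : ℕ → ℚ
1/[1+ m ] = + 1 / suc m

-- division p/q (only ever applied with q ≠ 0; returns 0 for q = 0)
divQ : ℚ → ℚ → ℚ
divQ p q with q ≟ 0ℚ
... | yes _  = 0ℚ
... | no q≢0 = _÷_ p q {{≢-nonZero q≢0}}

fromℕ : ℕ → ℚ
fromℕ k = + k / 1

fromℤ : ℤ → ℚ
fromℤ k = k / 1

module _ {n : ℕ} (G : Graph n) where

  ΣV : (Fin n → ℚ) → ℚ
  ΣV f = sumQ (map f (allFin n))

  ΣPairs : (Fin n → Fin n → ℚ) → ℚ
  ΣPairs f = ΣV λ u → ΣV λ v → if toℕ u <ᵇ toℕ v then f u v else 0ℚ

  ΣE : (Fin n → Fin n → ℚ) → ℚ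
  ΣE f = ΣPairs λ u v → if adj G u v then f u v else 0ℚ

  ΣNonE : (Fin n → Fin n → ℚ) → ℚ
  ΣNonE f = ΣPairs λ u v → if adj G u v then 0ℚ else f u v

  deg : Fin n → ℕ
  deg u = count (map (adj G u) (allFin n))

  numEdges : ℕ
  numEdges = sum (map (λ u → count (map (λ v → (toℕ u <ᵇ toℕ v) ∧ adj G u v) (allFin n))) (allFin n))

  minDeg : ℕ
  minDeg = foldr ℕ._⊓_ n (map deg (allFin n))

  commonNbrs : Fin n → Fin n → ℕ
  commonNbrs u v = count (map (λ w → adj G u w ∧ adj G v w) (allFin n))

  closedUnion : Fin n → Fin n → ℕ
  closedUnion u v =
    count (map (λ w → (toℕ w ≡ᵇ toℕ u) ∨ adj G u w ∨ (toℕ w ≡ᵇ toℕ v) ∨ adj G v w) (allFin n))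

  αCW : ℚ
  αCW = ΣV λ u → 1/[1+ deg u ]

  αS : ℚ
  αS = αCW ℚ.+ ΣV λ u →
         1/[1+ deg u ] ℚ.* ((+ deg u / suc (deg u)
                              ℚ.- ΣV (λ v → if adj G u v then 1/[1+ deg v ] else 0ℚ))
                            ⊔ 0ℚ)

  -- α_ACL
  -- the factor 1/(2+d(u)+d(v)-c) is written 1/[1+ 1+d(u)+d(v)-c ]
  -- (note c = |N(u)∩N(v)| ≤ d(u), so the truncated subtraction is exact)
  A : ℚ
  A = (ΣV λ u → + deg u / 1 ℚ.* (1/[1+ deg u ] ℚ.* 1/[1+ deg u ]))
      ℚ.- ΣE (λ u v → fromℕ 2 ℚ.* 1/[1+ deg u ] ℚ.* 1/[1+ deg v ])
      ℚ.+ ΣNonE (λ u v →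
             fromℕ (2 ℕ.* commonNbrs u v) ℚ.* 1/[1+ deg u ] ℚ.* 1/[1+ deg v ]
               ℚ.* 1/[1+ suc (deg u ℕ.+ deg v) ∸ commonNbrs u v ])

  αACL : ℚ
  αACL = αCW ℚ.+ divQ A (αCW ℚ.- 1ℚ)

  -- α_HR
  -- all ψ (as a list aligned with the degree list) with 0 ≤ ψ_i ≤ d_i
  assignments : List ℕ → List (List ℕ)
  assignments []       = [ [] ]
  assignments (d ∷ ds) = concatMap (λ p → map (p ∷_) (assignments ds)) (upTo (suc d))

  degList : List ℕ
  degList = map deg (allFin n)

  -- Σ_u 1/(d(u)+1-ψ(u))   (ψ(u) ≤ d(u), so d(u) ∸ ψ(u) is exact)
  ψValue : List ℕ → ℚ
  ψValue ψ = sumQ (zipWith (λ d p → 1/[1+ d ∸ p ]) degList ψ)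

  minMaybe : Maybe ℚ → ℚ → Maybe ℚ
  minMaybe nothing  q = just q
  minMaybe (just p) q = just (p ⊓ q)

  -- φ(G,l); nothing if there is no admissible ψ (i.e. l > 2|E|)
  φ : ℕ → Maybe ℚ
  φ l = foldr (λ ψ acc → if sum ψ ≡ᵇ l then minMaybe acc (ψValue ψ) else acc)
              nothing (assignments degList)

  hrTest : ℕ → Bool
  hrTest k with φ (2 ℕ.* (k ∸ 1))
  ... | nothing = false
  ... | just q  = q ≤ᵇ fromℕ k

  firstWith : (ℕ → Bool) → List ℕ → ℕ → ℕ
  firstWith P []       dflt = dflt
  firstWith P (k ∷ ks) dflt = if P k then k else firstWith P ks dflt

  -- smallest positive k with k ≥ φ(G,2(k-1)); the search over 1..|E|+1
  -- is exhaustive for connected G since k = |E|+1 always qualifies.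
  αHR : ℕ
  αHR = firstWith hrTest (map suc (upTo (suc numEdges))) (suc numEdges)

  a : ℕ → ℕ
  a t = sum (map (λ u → (n ∸ deg u ∸ 1) C (t ∸ 1)) (allFin n))

  b : ℕ → ℤ
  b t = ℤ.+ 2 ℤ.* foldr ℤ._+_ (+ 0) (map (λ u → foldr ℤ._+_ (+ 0) (map (λ v →
          if (toℕ u <ᵇ toℕ v) ∧ (if adj G u v then false else true)
          then (+ ((n ∸ deg u ∸ 1) C (t ∸ 2)) ℤ.+ + ((n ∸ deg v ∸ 1) C (t ∸ 2))
                ℤ.- + ((n ∸ closedUnion u v) C (t ∸ 2)))
          else + 0) (allFin n))) (allFin n))

  hmTerm : ℕ → ℚ
  hmTerm t = fromℕ (2 ℕ.* t ∸ 1) ℚ.- divQ (fromℤ (b t)) (fromℕ (a t))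

  -- max over 2 ≤ t ≤ n - δ  (nonempty since G is non-complete)
  αHM : ℚ
  αHM = foldr _⊔_ (hmTerm 2) (map (λ i → hmTerm (2 ℕ.+ i)) (upTo (n ∸ minDeg ∸ 1)))

ACL S HR HM : ΓGraph → ℚ
ACL G = αACL (graph G)
S   G = αS (graph G)
HR  G = fromℕ (αHR (graph G))
HM  G = αHM (graph G)

αFun : Fin 4 → ΓGraph → ℚ
αFun Fin.zero                             = ACL
αFun (Fin.suc Fin.zero)                   = S
αFun (Fin.suc (Fin.suc Fin.zero))         = HR
αFun (Fin.suc (Fin.suc (Fin.suc Fin.zero))) = HM

-- Part 1 is witnessed by the path P₃, the stars K₁,₃ and K₁,₄, a tree T₅ and a
-- graph G₇ on seven vertices, on which the four invariants are evaluated exactly;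
-- the inequalities α_ACL < α_HM and α_HR < α_HM come from the family of part 2.
--
-- Part 2: let G be a clique on s vertices joined completely to an independent set
-- of size s. Then α_CW = 1/2 + s/(s+1) lies in [4/3, 3/2], so α_S ≤ 2α_CW ≤ 3,
-- α_ACL ≤ α_CW + (α_CW + 2α_CW²)/(α_CW − 1) ≤ 20, and the assignment
-- ψ = (1, 1, 0, …, 0) gives α_HR ≤ 2. In α_HM only the independent set
-- contributes: a(G,t) = s·C(s−1,t−1) and b(G,t) = s(s−1)·(2C(s−1,t−2) − C(s−2,t−2)).
-- When r(r+2) ≤ s − 1 this gives b/a ≤ t + 1 at t = r + 2, hence α_HM ≥ r, and with
-- s = 6 + r(r+2) the ratio of part 2 is at least r/20.

module Submission where

open import Defs hiding (sym)

module Counting where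

  open import Data.Bool using (Bool; true; false; _∧_; _∨_; not; T; if_then_else_)
  open import Data.Nat as ℕ using (ℕ; zero; suc; _+_; _*_; _∸_; _<ᵇ_; _≡ᵇ_; _≤_; _<_; z≤n; s≤s)
  import Data.Nat.Properties as ℕₚ
  open import Data.Nat.ListAction using (sum)
  open import Data.Nat.Tactic.RingSolver using (solve-∀)
  open import Data.Integer as ℤ using (ℤ)
  import Data.Integer.Properties as ℤₚ
  open import Data.Fin using (toℕ)
  open import Data.List using (List; []; _∷_; foldr; map; applyUpTo; allFin; tabulate; _++_; replicate)
  import Data.List.Properties as Listₚ
  import Data.Bool.Properties as Boolₚ
  open import Function using (_∘_; id)
  open import Relation.Binary.PropositionalEquality
  open import Relation.Nullary using (yes; no)

  private variable X : Set

  <ᵇ-true : ∀ {i j} → i < j → (i <ᵇ j) ≡ true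
  <ᵇ-true {zero}  {suc j} _       = refl
  <ᵇ-true {suc i} {suc j} (s≤s p) = <ᵇ-true p

  <ᵇ-false : ∀ {i j} → j ≤ i → (i <ᵇ j) ≡ false
  <ᵇ-false {i}     {zero}  _       = refl
  <ᵇ-false {suc i} {suc j} (s≤s p) = <ᵇ-false p

  <ᵇ-true⁻¹ : ∀ {i j} → (i <ᵇ j) ≡ true → i < j
  <ᵇ-true⁻¹ {i} {j} e = ℕₚ.<ᵇ⇒< i j (subst T (sym e) _)

  <ᵇ-false⁻¹ : ∀ {i j} → (i <ᵇ j) ≡ false → j ≤ i
  <ᵇ-false⁻¹ {i} {j} e with i ℕₚ.<? j
  ... | yes i<j with () ← trans (sym (<ᵇ-true i<j)) e
  ... | no i≮j = ℕₚ.≮⇒≥ i≮j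

  ≡ᵇ-refl : ∀ i → (i ≡ᵇ i) ≡ true
  ≡ᵇ-refl zero    = refl
  ≡ᵇ-refl (suc i) = ≡ᵇ-refl i

  ≡ᵇ-false : ∀ {i j} → i ≢ j → (i ≡ᵇ j) ≡ false
  ≡ᵇ-false {zero}  {zero}  i≢j with () ← i≢j refl
  ≡ᵇ-false {zero}  {suc j} _   = refl
  ≡ᵇ-false {suc i} {zero}  _   = refl
  ≡ᵇ-false {suc i} {suc j} i≢j = ≡ᵇ-false (i≢j ∘ cong suc)

  ≡ᵇ-sym : ∀ i j → (i ≡ᵇ j) ≡ (j ≡ᵇ i)
  ≡ᵇ-sym zero    zero    = refl
  ≡ᵇ-sym zero    (suc j) = refl
  ≡ᵇ-sym (suc i) zero    = refl
  ≡ᵇ-sym (suc i) (suc j) = ≡ᵇ-sym i j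

  +-cancelˡ-≡ᵇ : ∀ k i j → (k + i ≡ᵇ k + j) ≡ (i ≡ᵇ j)
  +-cancelˡ-≡ᵇ zero    i j = refl
  +-cancelˡ-≡ᵇ (suc k) i j = +-cancelˡ-≡ᵇ k i j

  +-cancelˡ-<ᵇ : ∀ k i j → (k + i <ᵇ k + j) ≡ (i <ᵇ j)
  +-cancelˡ-<ᵇ zero    i j = refl
  +-cancelˡ-<ᵇ (suc k) i j = +-cancelˡ-<ᵇ k i j

  <⇒≢ : ∀ {i j} → i < j → i ≢ j
  <⇒≢ i<j refl = ℕₚ.<-irrefl refl i<j

  map-toℕ-allFin : ∀ n (h : ℕ → X) → map (h ∘ toℕ) (allFin n) ≡ applyUpTo h n
  map-toℕ-allFin n h = trans (Listₚ.map-tabulate id (h ∘ toℕ)) (tabulate-toℕ n h)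
    where
    tabulate-toℕ : ∀ n (h : ℕ → X) → tabulate {n = n} (h ∘ toℕ) ≡ applyUpTo h n
    tabulate-toℕ zero    h = refl
    tabulate-toℕ (suc n) h = cong (h 0 ∷_) (tabulate-toℕ n (h ∘ suc))

  applyUpTo-+ : ∀ (h : ℕ → X) k l →
                applyUpTo h (k + l) ≡ applyUpTo h k ++ applyUpTo (λ j → h (k + j)) l
  applyUpTo-+ h zero    l = refl
  applyUpTo-+ h (suc k) l = cong (h 0 ∷_) (applyUpTo-+ (h ∘ suc) k l)

  applyUpTo-cong : ∀ {f g : ℕ → X} k → (∀ j → f j ≡ g j) → applyUpTo f k ≡ applyUpTo g k
  applyUpTo-cong zero    f≗g = refl
  applyUpTo-cong (suc k) f≗g = cong₂ _∷_ (f≗g 0) (applyUpTo-cong k (f≗g ∘ suc))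

  applyUpTo-replicate : ∀ {f : ℕ → X} {x} k → (∀ j → j < k → f j ≡ x) → applyUpTo f k ≡ replicate k x
  applyUpTo-replicate zero    f≗x = refl
  applyUpTo-replicate (suc k) f≗x = cong₂ _∷_ (f≗x 0 (s≤s z≤n)) (applyUpTo-replicate k (λ j j<k → f≗x (suc j) (s≤s j<k)))

  count-++ : ∀ xs ys → count (xs ++ ys) ≡ count xs + count ys
  count-++ []           ys = refl
  count-++ (true ∷ xs)  ys = cong suc (count-++ xs ys)
  count-++ (false ∷ xs) ys = count-++ xs ys

  count-applyUpTo-+ : ∀ (p : ℕ → Bool) k l →
    count (applyUpTo p (k + l)) ≡ count (applyUpTo p k) + count (applyUpTo (λ j → p (k + j)) l)
  count-applyUpTo-+ p k l = trans (cong count (applyUpTo-+ p k l)) (count-++ (applyUpTo p k) _)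

  count-applyUpTo-true : ∀ {p : ℕ → Bool} k → (∀ j → j < k → p j ≡ true) → count (applyUpTo p k) ≡ k
  count-applyUpTo-true zero    _ = refl
  count-applyUpTo-true {p} (suc k) p≗true with p 0 | p≗true 0 (s≤s z≤n)
  ... | true | refl = cong suc (count-applyUpTo-true k (λ j j<k → p≗true (suc j) (s≤s j<k)))

  count-applyUpTo-false : ∀ {p : ℕ → Bool} k → (∀ j → j < k → p j ≡ false) → count (applyUpTo p k) ≡ 0
  count-applyUpTo-false zero    _ = refl
  count-applyUpTo-false {p} (suc k) p≗false with p 0 | p≗false 0 (s≤s z≤n)
  ... | false | refl = count-applyUpTo-false k (λ j j<k → p≗false (suc j) (s≤s j<k))

  count-≡ᵇ : ∀ {a} s → a < s → count (applyUpTo (_≡ᵇ a) s) ≡ 1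
  count-≡ᵇ {zero}  (suc s) _         = cong suc (count-applyUpTo-false s (λ _ _ → refl))
  count-≡ᵇ {suc a} (suc s) (s≤s a<s) = count-≡ᵇ s a<s

  count-≡ᵇ-∨ : ∀ {a b} s → a ≢ b → a < s → b < s →
               count (applyUpTo (λ k → (k ≡ᵇ a) ∨ (k ≡ᵇ b)) s) ≡ 2
  count-≡ᵇ-∨ {zero}  {zero}  s       a≢b _ _ with () ← a≢b refl
  count-≡ᵇ-∨ {zero}  {suc b} (suc s) _   _ (s≤s b<s) = cong suc (count-≡ᵇ s b<s)
  count-≡ᵇ-∨ {suc a} {zero}  (suc s) _   (s≤s a<s) _ =
    cong suc (trans (cong count (applyUpTo-cong s (λ k → Boolₚ.∨-identityʳ (k ≡ᵇ a)))) (count-≡ᵇ s a<s))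
  count-≡ᵇ-∨ {suc a} {suc b} (suc s) a≢b (s≤s a<s) (s≤s b<s) = count-≡ᵇ-∨ s (a≢b ∘ cong suc) a<s b<s

  count-≢ᵇ : ∀ {i} N → i < N → count (applyUpTo (λ j → not (i ≡ᵇ j)) N) ≡ ℕ.pred N
  count-≢ᵇ {zero}  (suc N)       _         = count-applyUpTo-true N (λ _ _ → refl)
  count-≢ᵇ {suc i} (suc (suc N)) (s≤s i<N) = cong suc (count-≢ᵇ (suc N) i<N)

  count-<ᵇ : ∀ k s → count (applyUpTo (k <ᵇ_) s) ≡ s ∸ suc k
  count-<ᵇ k       zero    = refl
  count-<ᵇ zero    (suc s) = count-applyUpTo-true s (λ _ _ → refl)
  count-<ᵇ (suc k) (suc s) = count-<ᵇ k s

  count-∧-≤ˡ : ∀ (p q : X → Bool) xs → count (map (λ x → p x ∧ q x) xs) ≤ count (map p xs)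
  count-∧-≤ˡ p q []       = z≤n
  count-∧-≤ˡ p q (x ∷ xs) with p x | q x
  ... | true  | true  = s≤s (count-∧-≤ˡ p q xs)
  ... | true  | false = ℕₚ.m≤n⇒m≤1+n (count-∧-≤ˡ p q xs)
  ... | false | _     = count-∧-≤ˡ p q xs

  count-∧-≤ʳ : ∀ (p q : X → Bool) xs → count (map (λ x → p x ∧ q x) xs) ≤ count (map q xs)
  count-∧-≤ʳ p q xs = subst (_≤ count (map q xs))
    (cong count (Listₚ.map-cong (λ x → Boolₚ.∧-comm (q x) (p x)) xs)) (count-∧-≤ˡ q p xs)

  sum-replicate : ∀ k x → sum (replicate k x) ≡ k * x
  sum-replicate zero    x = refl
  sum-replicate (suc k) x = cong (x +_) (sum-replicate k x)

  sumℤ : List ℤ → ℤ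
  sumℤ = foldr ℤ._+_ (ℤ.+ 0)

  sumℤ-if : ∀ (c : X → Bool) z xs → sumℤ (map (λ x → if c x then z else ℤ.+ 0) xs) ≡ ℤ.+ count (map c xs) ℤ.* z
  sumℤ-if c z []       = refl
  sumℤ-if c z (x ∷ xs) with c x
  ... | true  = trans (cong (λ w → z ℤ.+ w) (sumℤ-if c z xs)) (sym (+1+k*z (count (map c xs))))
    where
    +1+k*z : ∀ k → ℤ.+ suc k ℤ.* z ≡ z ℤ.+ ℤ.+ k ℤ.* z
    +1+k*z k = trans (cong (ℤ._* z) (ℤₚ.pos-+ 1 k))
               (trans (ℤₚ.*-distribʳ-+ z (ℤ.+ 1) (ℤ.+ k)) (cong (λ w → w ℤ.+ ℤ.+ k ℤ.* z) (ℤₚ.*-identityˡ z)))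
  ... | false = trans (ℤₚ.+-identityˡ _) (sumℤ-if c z xs)

  sumℤ-*ʳ : ∀ (f : X → ℕ) z xs → sumℤ (map (λ x → ℤ.+ f x ℤ.* z) xs) ≡ ℤ.+ sum (map f xs) ℤ.* z
  sumℤ-*ʳ f z []       = sym (ℤₚ.*-zeroˡ z)
  sumℤ-*ʳ f z (x ∷ xs) = begin
    ℤ.+ f x ℤ.* z ℤ.+ sumℤ (map (λ x → ℤ.+ f x ℤ.* z) xs) ≡⟨ cong (λ w → ℤ.+ f x ℤ.* z ℤ.+ w) (sumℤ-*ʳ f z xs) ⟩
    ℤ.+ f x ℤ.* z ℤ.+ ℤ.+ sum (map f xs) ℤ.* z          ≡⟨ sym (ℤₚ.*-distribʳ-+ z (ℤ.+ f x) (ℤ.+ sum (map f xs))) ⟩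
    (ℤ.+ f x ℤ.+ ℤ.+ sum (map f xs)) ℤ.* z              ≡⟨ cong (ℤ._* z) (sym (ℤₚ.pos-+ (f x) (sum (map f xs)))) ⟩
    ℤ.+ sum (map f (x ∷ xs)) ℤ.* z                      ∎
    where open ≡-Reasoning

  if-cong : ∀ {c c′ : Bool} {x y z : X} → c ≡ c′ → (c′ ≡ true → x ≡ y) → (if c then x else z) ≡ (if c′ then y else z)
  if-cong {c′ = true}  refl x≡y = x≡y refl
  if-cong {c′ = false} refl _   = refl

  pairCount : ℕ → ℕ
  pairCount s = sum (applyUpTo (λ k → s ∸ suc k) s)

  *-2-pairCount : ∀ s → 2 * pairCount s ≡ s * (s ∸ 1)
  *-2-pairCount zero          = refl
  *-2-pairCount (suc zero)    = refl
  *-2-pairCount (suc (suc s)) = begin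
    2 * (suc s + pairCount (suc s))     ≡⟨ ℕₚ.*-distribˡ-+ 2 (suc s) (pairCount (suc s)) ⟩
    2 * suc s + 2 * pairCount (suc s)   ≡⟨ cong (2 * suc s +_) (*-2-pairCount (suc s)) ⟩
    2 * suc s + suc s * s               ≡⟨ expand s ⟩
    suc (suc s) * suc s                 ∎
    where
    open ≡-Reasoning
    expand : ∀ s → 2 * suc s + suc s * s ≡ suc (suc s) * suc s
    expand = solve-∀

  m+k≡n⇒m≤n : ∀ {m n} k → m + k ≡ n → m ≤ n
  m+k≡n⇒m≤n {m} k refl = ℕₚ.m≤m+n m k

open Counting

module Rationals where

  open import Data.Nat as ℕ using (ℕ; zero; suc)
  import Data.Nat.Properties as ℕₚ
  open import Data.Integer as ℤ using ()
  import Data.Integer.Properties as ℤₚ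
  open import Data.Rational as ℚ using (ℚ; 0ℚ; 1ℚ; _/_; _≤_; _<_; _+_; _*_; _÷_)
  import Data.Rational.Properties as ℚₚ
  open import Data.Rational.Unnormalised as ℚᵘ using (mkℚᵘ; *≤*; *<*)
  import Data.Rational.Unnormalised.Properties as ℚᵘₚ
  open import Data.List using ([]; _∷_; map; _++_; replicate)
  open import Relation.Binary.PropositionalEquality
  open import Relation.Nullary using (yes; no)

  private variable X : Set

  -- Defs writes 1/(d+1) as 1/[1+ d ] and k as fromℕ k; these are definitionally
  -- 1 /suc d and k /suc 0, so the lemmas below apply to them directly. Their
  -- numerals are explicit: p /suc q normalises through a gcd computation, so
  -- Agda cannot recover p and q from a goal.
  infix 8 _/suc_
  _/suc_ : ℕ → ℕ → ℚ
  p /suc q = ℤ.+ p / suc q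

  private
    toℚᵘ-/suc : ∀ p q → ℚ.toℚᵘ (p /suc q) ℚᵘ.≃ mkℚᵘ (ℤ.+ p) q
    toℚᵘ-/suc p q = ℚₚ.toℚᵘ-fromℚᵘ (mkℚᵘ (ℤ.+ p) q)

  /suc-+ : ∀ p q p′ q′ → p /suc q + p′ /suc q′ ≡ (p ℕ.* suc q′ ℕ.+ p′ ℕ.* suc q) /suc (q′ ℕ.+ q ℕ.* suc q′)
  /suc-+ p q p′ q′ = ℚₚ.toℚᵘ-injective (begin
    ℚ.toℚᵘ (p /suc q + p′ /suc q′)                 ≈⟨ ℚₚ.toℚᵘ-homo-+ (p /suc q) (p′ /suc q′) ⟩
    ℚ.toℚᵘ (p /suc q) ℚᵘ.+ ℚ.toℚᵘ (p′ /suc q′)     ≈⟨ ℚᵘₚ.+-cong (toℚᵘ-/suc p q) (toℚᵘ-/suc p′ q′) ⟩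
    mkℚᵘ (ℤ.+ p ℤ.* ℤ.+ suc q′ ℤ.+ ℤ.+ p′ ℤ.* ℤ.+ suc q) _ ≡⟨ cong (λ z → mkℚᵘ z (q′ ℕ.+ q ℕ.* suc q′)) numerator ⟩
    mkℚᵘ (ℤ.+ (p ℕ.* suc q′ ℕ.+ p′ ℕ.* suc q)) _     ≈⟨ ℚᵘₚ.≃-sym (toℚᵘ-/suc _ _) ⟩
    ℚ.toℚᵘ ((p ℕ.* suc q′ ℕ.+ p′ ℕ.* suc q) /suc (q′ ℕ.+ q ℕ.* suc q′)) ∎)
    where
    open ℚᵘₚ.≃-Reasoning
    numerator : ℤ.+ p ℤ.* ℤ.+ suc q′ ℤ.+ ℤ.+ p′ ℤ.* ℤ.+ suc q ≡ ℤ.+ (p ℕ.* suc q′ ℕ.+ p′ ℕ.* suc q)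
    numerator = trans (cong₂ ℤ._+_ (sym (ℤₚ.pos-* p (suc q′))) (sym (ℤₚ.pos-* p′ (suc q))))
                      (sym (ℤₚ.pos-+ (p ℕ.* suc q′) (p′ ℕ.* suc q)))

  /suc-* : ∀ p q p′ q′ → p /suc q * p′ /suc q′ ≡ (p ℕ.* p′) /suc (q′ ℕ.+ q ℕ.* suc q′)
  /suc-* p q p′ q′ = ℚₚ.toℚᵘ-injective (begin
    ℚ.toℚᵘ (p /suc q * p′ /suc q′)             ≈⟨ ℚₚ.toℚᵘ-homo-* (p /suc q) (p′ /suc q′) ⟩
    ℚ.toℚᵘ (p /suc q) ℚᵘ.* ℚ.toℚᵘ (p′ /suc q′) ≈⟨ ℚᵘₚ.*-cong (toℚᵘ-/suc p q) (toℚᵘ-/suc p′ q′) ⟩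
    mkℚᵘ (ℤ.+ p ℤ.* ℤ.+ p′) _                       ≡⟨ cong (λ z → mkℚᵘ z (q′ ℕ.+ q ℕ.* suc q′)) (sym (ℤₚ.pos-* p p′)) ⟩
    mkℚᵘ (ℤ.+ (p ℕ.* p′)) _                       ≈⟨ ℚᵘₚ.≃-sym (toℚᵘ-/suc _ _) ⟩
    ℚ.toℚᵘ ((p ℕ.* p′) /suc (q′ ℕ.+ q ℕ.* suc q′)) ∎)
    where open ℚᵘₚ.≃-Reasoning

  /suc-≤ : ∀ p q p′ q′ → p ℕ.* suc q′ ℕ.≤ p′ ℕ.* suc q → p /suc q ≤ p′ /suc q′
  /suc-≤ p q p′ q′ le = ℚₚ.toℚᵘ-cancel-≤
    (ℚᵘₚ.≤-respˡ-≃ (ℚᵘₚ.≃-sym (toℚᵘ-/suc p q)) (ℚᵘₚ.≤-respʳ-≃ (ℚᵘₚ.≃-sym (toℚᵘ-/suc p′ q′))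
      (*≤* (subst₂ ℤ._≤_ (ℤₚ.pos-* p (suc q′)) (ℤₚ.pos-* p′ (suc q)) (ℤ.+≤+ le)))))

  /suc-< : ∀ p q p′ q′ → p ℕ.* suc q′ ℕ.< p′ ℕ.* suc q → p /suc q < p′ /suc q′
  /suc-< p q p′ q′ lt = ℚₚ.toℚᵘ-cancel-<
    (ℚᵘₚ.<-respˡ-≃ (ℚᵘₚ.≃-sym (toℚᵘ-/suc p q)) (ℚᵘₚ.<-respʳ-≃ (ℚᵘₚ.≃-sym (toℚᵘ-/suc p′ q′))
      (*<* (subst₂ ℤ._<_ (ℤₚ.pos-* p (suc q′)) (ℤₚ.pos-* p′ (suc q)) (ℤ.+<+ lt)))))

  /suc-≡ : ∀ p q p′ q′ → p ℕ.* suc q′ ≡ p′ ℕ.* suc q → p /suc q ≡ p′ /suc q′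
  /suc-≡ p q p′ q′ e =
    ℚₚ.≤-antisym (/suc-≤ p q p′ q′ (ℕₚ.≤-reflexive e)) (/suc-≤ p′ q′ p q (ℕₚ.≤-reflexive (sym e)))

  fromℕ-+ : ∀ p q → fromℕ p + fromℕ q ≡ fromℕ (p ℕ.+ q)
  fromℕ-+ p q = trans (/suc-+ p 0 q 0) (cong₂ (λ x y → (x ℕ.+ y) /suc 0) (ℕₚ.*-identityʳ p) (ℕₚ.*-identityʳ q))

  fromℕ-* : ∀ p q → fromℕ p * fromℕ q ≡ fromℕ (p ℕ.* q)
  fromℕ-* p q = /suc-* p 0 q 0

  fromℕ-mono-≤ : ∀ {p q} → p ℕ.≤ q → fromℕ p ≤ fromℕ q
  fromℕ-mono-≤ {p} {q} le = /suc-≤ p 0 q 0 (subst₂ ℕ._≤_ (sym (ℕₚ.*-identityʳ p)) (sym (ℕₚ.*-identityʳ q)) le)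

  fromℕ-mono-< : ∀ {p q} → p ℕ.< q → fromℕ p < fromℕ q
  fromℕ-mono-< {p} {q} lt = /suc-< p 0 q 0 (subst₂ ℕ._<_ (sym (ℕₚ.*-identityʳ p)) (sym (ℕₚ.*-identityʳ q)) lt)

  0≤/suc : ∀ p q → 0ℚ ≤ p /suc q
  0≤/suc p q = /suc-≤ 0 0 p q ℕ.z≤n

  *-0≤ : ∀ {p q} → 0ℚ ≤ p → 0ℚ ≤ q → 0ℚ ≤ p * q
  *-0≤ {p} {q} 0≤p 0≤q = ℚₚ.nonNegative⁻¹ _ {{ℚₚ.nonNeg*nonNeg⇒nonNeg p {{ℚ.nonNegative 0≤p}} q {{ℚ.nonNegative 0≤q}}}}

  *-monoˡ-≤-0≤ : ∀ {r p q} → 0ℚ ≤ r → p ≤ q → r * p ≤ r * q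
  *-monoˡ-≤-0≤ {r} 0≤r = ℚₚ.*-monoˡ-≤-nonNeg r {{ℚ.nonNegative 0≤r}}

  *-monoʳ-≤-0≤ : ∀ {r p q} → 0ℚ ≤ r → p ≤ q → p * r ≤ q * r
  *-monoʳ-≤-0≤ {r} 0≤r = ℚₚ.*-monoʳ-≤-nonNeg r {{ℚ.nonNegative 0≤r}}

  -‿≤ : ∀ p {q} → 0ℚ ≤ q → p ℚ.- q ≤ p
  -‿≤ p 0≤q = ℚₚ.≤-trans (ℚₚ.+-monoʳ-≤ p (ℚₚ.neg-antimono-≤ 0≤q)) (ℚₚ.≤-reflexive (ℚₚ.+-identityʳ p))

  divQ-*-cancel : ∀ {p q} → 0ℚ < q → divQ p q * q ≡ p
  divQ-*-cancel {p} {q} 0<q with q ℚₚ.≟ 0ℚ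
  ... | yes refl with () ← ℚₚ.<-irrefl refl 0<q
  ... | no q≢0 = begin
    (p ÷ q) * q            ≡⟨ ℚₚ.*-assoc p (ℚ.1/ q) q ⟩
    p * (ℚ.1/ q * q)       ≡⟨ cong (p *_) (ℚₚ.*-inverseˡ q) ⟩
    p * 1ℚ                 ≡⟨ ℚₚ.*-identityʳ p ⟩
    p                      ∎
    where
    open ≡-Reasoning
    instance _ = ℚ.≢-nonZero q≢0

  divQ-≤ : ∀ {p q B} → 0ℚ < q → p ≤ B * q → divQ p q ≤ B
  divQ-≤ {p} {q} {B} 0<q p≤Bq = ℚₚ.*-cancelʳ-≤-pos q {{ℚ.positive 0<q}}
    (subst (_≤ B * q) (sym (divQ-*-cancel 0<q)) p≤Bq)

  <-divQ : ∀ {p q B} → 0ℚ < q → B * q < p → B < divQ p q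
  <-divQ {p} {q} 0<q Bq<p = ℚₚ.*-cancelʳ-<-nonNeg q {{ℚ.nonNegative (ℚₚ.<⇒≤ 0<q)}}
    (ℚₚ.<-respʳ-≡ (sym (divQ-*-cancel 0<q)) Bq<p)

  sumQ-mono-≤ : ∀ (f g : X → ℚ) xs → (∀ x → f x ≤ g x) → sumQ (map f xs) ≤ sumQ (map g xs)
  sumQ-mono-≤ f g []       f≤g = ℚₚ.≤-refl
  sumQ-mono-≤ f g (x ∷ xs) f≤g = ℚₚ.+-mono-≤ (f≤g x) (sumQ-mono-≤ f g xs f≤g)

  sumQ-0≤ : ∀ (f : X → ℚ) xs → (∀ x → 0ℚ ≤ f x) → 0ℚ ≤ sumQ (map f xs)
  sumQ-0≤ f []       0≤f = ℚₚ.≤-refl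
  sumQ-0≤ f (x ∷ xs) 0≤f = ℚₚ.≤-trans (ℚₚ.≤-reflexive (sym (ℚₚ.+-identityˡ 0ℚ)))
                                      (ℚₚ.+-mono-≤ (0≤f x) (sumQ-0≤ f xs 0≤f))

  sumQ-*ˡ : ∀ c (f : X → ℚ) xs → sumQ (map (λ x → c * f x) xs) ≡ c * sumQ (map f xs)
  sumQ-*ˡ c f []       = sym (ℚₚ.*-zeroʳ c)
  sumQ-*ˡ c f (x ∷ xs) = trans (cong (λ y → c * f x + y) (sumQ-*ˡ c f xs)) (sym (ℚₚ.*-distribˡ-+ c (f x) _))

  sumQ-++ : ∀ xs ys → sumQ (xs ++ ys) ≡ sumQ xs + sumQ ys
  sumQ-++ []       ys = sym (ℚₚ.+-identityˡ _)
  sumQ-++ (x ∷ xs) ys = trans (cong (λ y → x + y) (sumQ-++ xs ys)) (sym (ℚₚ.+-assoc x _ _))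

  sumQ-replicate : ∀ k x → sumQ (replicate k x) ≡ fromℕ k * x
  sumQ-replicate zero    x = sym (ℚₚ.*-zeroˡ x)
  sumQ-replicate (suc k) x = begin
    x + sumQ (replicate k x)     ≡⟨ cong (λ y → x + y) (sumQ-replicate k x) ⟩
    x + fromℕ k * x              ≡⟨ cong (_+ fromℕ k * x) (sym (ℚₚ.*-identityˡ x)) ⟩
    1ℚ * x + fromℕ k * x         ≡⟨ sym (ℚₚ.*-distribʳ-+ x 1ℚ (fromℕ k)) ⟩
    (1ℚ + fromℕ k) * x           ≡⟨ cong (_* x) (fromℕ-+ 1 k) ⟩
    fromℕ (suc k) * x            ∎
    where open ≡-Reasoning

  ≤-fromℕ-∣↥∣ : ∀ p → p ≤ fromℕ ℤ.∣ ℚ.↥ p ∣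
  ≤-fromℕ-∣↥∣ (ℚ.mkℚ (ℤ.+ k) d _) = ℚₚ.toℚᵘ-cancel-≤ (ℚᵘₚ.≤-respʳ-≃ (ℚᵘₚ.≃-sym (toℚᵘ-/suc k 0))
    (*≤* (subst₂ ℤ._≤_ (ℤₚ.pos-* k 1) (ℤₚ.pos-* k (suc d)) (ℤ.+≤+ (ℕₚ.*-monoʳ-≤ k (ℕ.s≤s ℕ.z≤n))))))
  ≤-fromℕ-∣↥∣ (ℚ.mkℚ ℤ.-[1+ k ] d _) = ℚₚ.toℚᵘ-cancel-≤ (ℚᵘₚ.≤-respʳ-≃ (ℚᵘₚ.≃-sym (toℚᵘ-/suc (suc k) 0)) (*≤* ℤ.-≤+))

  k/suc-k≤1 : ∀ k → k /suc k ≤ 1ℚ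
  k/suc-k≤1 k = /suc-≤ k k 1 0 (subst₂ ℕ._≤_ (sym (ℕₚ.*-identityʳ k)) (sym (ℕₚ.*-identityˡ (suc k))) (ℕₚ.n≤1+n k))

  p+q-q≡p : ∀ p q → p + q ℚ.- q ≡ p
  p+q-q≡p p q = trans (ℚₚ.+-assoc p q (ℚ.- q)) (trans (cong (p +_) (ℚₚ.+-inverseʳ q)) (ℚₚ.+-identityʳ p))

open Rationals

module GeneralBounds where

  open import Data.Bool using (true; false; if_then_else_)
  open import Data.Nat as ℕ using (ℕ; zero; suc; _∸_; _≡ᵇ_; z≤n; s≤s)
  import Data.Nat.Properties as ℕₚ
  open import Data.Nat.ListAction using (sum)
  open import Data.Nat.Tactic.RingSolver using (solve-∀)
  open import Data.Rational as ℚ using (ℚ; 0ℚ; 1ℚ; _≤_; _+_; _*_; _⊔_; _⊓_)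
  import Data.Rational.Properties as ℚₚ
  open import Data.Fin using (Fin; toℕ)
  open import Data.List using (List; []; _∷_; map; foldr; allFin; upTo; zipWith)
  import Data.List.Properties as Listₚ
  open import Data.List.Membership.Propositional using (_∈_)
  import Data.List.Membership.Propositional.Properties as ∈ₚ
  open import Data.List.Relation.Unary.All using (All; []; _∷_)
  open import Data.List.Relation.Unary.Any as Any using (here; there)
  open import Data.List.Relation.Binary.Pointwise using (Pointwise; []; _∷_)
  open import Data.Maybe using (just; nothing)
  open import Data.Product using (∃-syntax; _×_; _,_)
  open import Relation.Binary.PropositionalEquality
  open import Function.Bundles using (Equivalence)
  import Data.Bool.Properties as Boolₚ

  private variable X : Set

  if-≤ : ∀ b {x y z : ℚ} → x ≤ z → y ≤ z → (if b then x else y) ≤ z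
  if-≤ true  x≤z _   = x≤z
  if-≤ false _   y≤z = y≤z

  ≤-if : ∀ b {x y z : ℚ} → z ≤ x → z ≤ y → z ≤ (if b then x else y)
  ≤-if true  z≤x _   = z≤x
  ≤-if false _   z≤y = z≤y

  1/[1+]-0≤ : ∀ d → 0ℚ ≤ 1/[1+ d ]
  1/[1+]-0≤ = 0≤/suc 1

  foldr-⊔-≥ : ∀ (f : X → ℚ) z {x xs} → x ∈ xs → f x ≤ foldr _⊔_ z (map f xs)
  foldr-⊔-≥ f z {xs = y ∷ xs} (here refl)  = ℚₚ.p≤p⊔q (f y) _
  foldr-⊔-≥ f z {xs = y ∷ xs} (there x∈xs) = ℚₚ.≤-trans (foldr-⊔-≥ f z x∈xs) (ℚₚ.p≤q⊔p (f y) _)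

  foldr-⊓-≤ : ∀ (f : X → ℕ) z {x xs} → x ∈ xs → foldr ℕ._⊓_ z (map f xs) ℕ.≤ f x
  foldr-⊓-≤ f z {xs = y ∷ xs} (here refl)  = ℕₚ.m⊓n≤m (f y) _
  foldr-⊓-≤ f z {xs = y ∷ xs} (there x∈xs) = ℕₚ.≤-trans (ℕₚ.m⊓n≤n (f y) _) (foldr-⊓-≤ f z x∈xs)

  module _ {n : ℕ} (G : Graph n) where

    private
      w : Fin n → ℚ
      w u = 1/[1+ deg G u ]

    αCW-0≤ : 0ℚ ≤ αCW G
    αCW-0≤ = sumQ-0≤ w (allFin n) (λ u → 1/[1+]-0≤ (deg G u))

    αS≤2αCW : αS G ≤ αCW G + αCW G
    αS≤2αCW = ℚₚ.+-monoʳ-≤ (αCW G) (sumQ-mono-≤ _ w (allFin n) surplus≤w)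
      where
      surplus≤w : ∀ u → w u * ((deg G u /suc deg G u ℚ.- ΣV G (λ v → if adj G u v then w v else 0ℚ)) ⊔ 0ℚ) ≤ w u
      surplus≤w u = ℚₚ.≤-trans (*-monoˡ-≤-0≤ (1/[1+]-0≤ (deg G u)) (ℚₚ.⊔-lub surplus≤1 (0≤/suc 1 0)))
                               (ℚₚ.≤-reflexive (ℚₚ.*-identityʳ (w u)))
        where
        d : ℕ
        d = deg G u
        surplus≤1 : d /suc d ℚ.- ΣV G (λ v → if adj G u v then w v else 0ℚ) ≤ 1ℚ
        surplus≤1 = ℚₚ.≤-trans (-‿≤ _ (sumQ-0≤ _ (allFin n) (λ v → ≤-if (adj G u v) (1/[1+]-0≤ (deg G v)) ℚₚ.≤-refl)))
                               (k/suc-k≤1 d)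

    private
      2ww : Fin n → Fin n → ℚ
      2ww u v = fromℕ 2 * w u * w v

      2ww-0≤ : ∀ u v → 0ℚ ≤ 2ww u v
      2ww-0≤ u v = *-0≤ (*-0≤ (0≤/suc 2 0) (1/[1+]-0≤ (deg G u))) (1/[1+]-0≤ (deg G v))

      ΣPairs-≤ : ∀ (f : Fin n → Fin n → ℚ) → (∀ u v → f u v ≤ 2ww u v) →
                 ΣPairs G f ≤ fromℕ 2 * αCW G * αCW G
      ΣPairs-≤ f f≤ = ℚₚ.≤-trans
        (sumQ-mono-≤ _ _ (allFin n) (λ u → sumQ-mono-≤ _ _ (allFin n) (λ v →
          if-≤ (toℕ u ℕ.<ᵇ toℕ v) (f≤ u v) (2ww-0≤ u v))))
        (ℚₚ.≤-reflexive (begin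
          ΣV G (λ u → ΣV G (λ v → fromℕ 2 * w u * w v))   ≡⟨ cong sumQ (Listₚ.map-cong (λ u → sumQ-*ˡ (fromℕ 2 * w u) w (allFin n)) (allFin n)) ⟩
          ΣV G (λ u → fromℕ 2 * w u * αCW G)              ≡⟨ cong sumQ (Listₚ.map-cong (λ u → ℚₚ.*-comm (fromℕ 2 * w u) (αCW G)) (allFin n)) ⟩
          ΣV G (λ u → αCW G * (fromℕ 2 * w u))            ≡⟨ sumQ-*ˡ (αCW G) _ (allFin n) ⟩
          αCW G * ΣV G (λ u → fromℕ 2 * w u)              ≡⟨ cong (αCW G *_) (sumQ-*ˡ (fromℕ 2) w (allFin n)) ⟩
          αCW G * (fromℕ 2 * αCW G)                       ≡⟨ ℚₚ.*-comm (αCW G) _ ⟩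
          fromℕ 2 * αCW G * αCW G                         ∎))
        where open ≡-Reasoning

    commonNbrs≤[1+deg+deg]∸commonNbrs : ∀ u v → commonNbrs G u v ℕ.≤ suc (deg G u ℕ.+ deg G v) ∸ commonNbrs G u v
    commonNbrs≤[1+deg+deg]∸commonNbrs u v = begin
      c                              ≤⟨ count-∧-≤ʳ (adj G u) (adj G v) (allFin n) ⟩
      deg G v                        ≤⟨ ℕₚ.n≤1+n (deg G v) ⟩
      suc (deg G v)                  ≤⟨ ℕₚ.m≤n+m (suc (deg G v)) (deg G u ∸ c) ⟩
      deg G u ∸ c ℕ.+ suc (deg G v)  ≡⟨ sym (ℕₚ.+-∸-comm (suc (deg G v)) (count-∧-≤ˡ (adj G u) (adj G v) (allFin n))) ⟩
      deg G u ℕ.+ suc (deg G v) ∸ c  ≡⟨ cong (_∸ c) (ℕₚ.+-suc (deg G u) (deg G v)) ⟩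
      suc (deg G u ℕ.+ deg G v) ∸ c  ∎
      where
      open ℕₚ.≤-Reasoning
      c : ℕ
      c = commonNbrs G u v

    -- Each non-edge term is at most 2/((d(u)+1)(d(v)+1)) because c = |N(u) ∩ N(v)|
    -- satisfies c ≤ 1 + d(u) + d(v) − c; the edge term is dropped.
    A≤ : A G ≤ αCW G + fromℕ 2 * αCW G * αCW G
    A≤ = ℚₚ.+-mono-≤ (ℚₚ.≤-trans (-‿≤ _ edgeTerm-0≤) (sumQ-mono-≤ _ w (allFin n) (λ u → degTerm≤ (deg G u))))
                     (ΣPairs-≤ _ (λ u v → if-≤ (adj G u v) (2ww-0≤ u v) (nonEdgeTerm≤ u v)))
      where
      degTerm≤ : ∀ d → fromℕ d * (1/[1+ d ] * 1/[1+ d ]) ≤ 1/[1+ d ]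
      degTerm≤ d = subst (_≤ 1/[1+ d ]) (sym (trans (cong (fromℕ d *_) (/suc-* 1 d 1 d)) (/suc-* d 0 (1 ℕ.* 1) (d ℕ.+ d ℕ.* suc d))))
                         (/suc-≤ (d ℕ.* (1 ℕ.* 1)) ((d ℕ.+ d ℕ.* suc d) ℕ.+ 0 ℕ.* suc (d ℕ.+ d ℕ.* suc d)) 1 d
                           (m+k≡n⇒m≤n (suc d) (cross d)))
        where
        cross : ∀ d → d ℕ.* (1 ℕ.* 1) ℕ.* suc d ℕ.+ suc d ≡ 1 ℕ.* suc ((d ℕ.+ d ℕ.* suc d) ℕ.+ 0 ℕ.* suc (d ℕ.+ d ℕ.* suc d))
        cross = solve-∀

      edgeTerm-0≤ : 0ℚ ≤ ΣE G 2ww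
      edgeTerm-0≤ = sumQ-0≤ _ (allFin n) (λ u → sumQ-0≤ _ (allFin n) (λ v →
                      ≤-if (toℕ u ℕ.<ᵇ toℕ v) (≤-if (adj G u v) (2ww-0≤ u v) ℚₚ.≤-refl) ℚₚ.≤-refl))

      nonEdgeTerm≤ : ∀ u v → fromℕ (2 ℕ.* commonNbrs G u v) * w u * w v
                               * 1/[1+ suc (deg G u ℕ.+ deg G v) ∸ commonNbrs G u v ] ≤ 2ww u v
      nonEdgeTerm≤ u v = begin
        2c * w u * w v * e     ≡⟨ cong (_* e) (ℚₚ.*-assoc 2c (w u) (w v)) ⟩
        2c * (w u * w v) * e   ≡⟨ ℚₚ.*-assoc 2c _ e ⟩
        2c * (w u * w v * e)   ≡⟨ cong (2c *_) (ℚₚ.*-comm _ e) ⟩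
        2c * (e * (w u * w v)) ≡⟨ sym (ℚₚ.*-assoc 2c e _) ⟩
        2c * e * (w u * w v)   ≤⟨ *-monoʳ-≤-0≤ (*-0≤ (1/[1+]-0≤ (deg G u)) (1/[1+]-0≤ (deg G v))) 2c*e≤2 ⟩
        fromℕ 2 * (w u * w v) ≡⟨ sym (ℚₚ.*-assoc (fromℕ 2) (w u) (w v)) ⟩
        2ww u v               ∎
        where
        open ℚₚ.≤-Reasoning
        c : ℕ
        c = commonNbrs G u v
        2c : ℚ
        2c = fromℕ (2 ℕ.* c)
        m : ℕ
        m = suc (deg G u ℕ.+ deg G v) ∸ c
        e : ℚ
        e = 1/[1+ m ]
        2c*e≤2 : 2c * e ≤ fromℕ 2
        2c*e≤2 = subst (_≤ fromℕ 2) (sym (/suc-* (2 ℕ.* c) 0 1 m))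
                  (/suc-≤ (2 ℕ.* c ℕ.* 1) (m ℕ.+ 0 ℕ.* suc m) 2 0 (ℕₚ.≤-trans (ℕₚ.≤-reflexive (trans (ℕₚ.*-identityʳ _) (ℕₚ.*-identityʳ _)))
                    (ℕₚ.*-monoʳ-≤ 2 (ℕₚ.≤-trans (commonNbrs≤[1+deg+deg]∸commonNbrs u v) (ℕₚ.≤-trans (ℕₚ.n≤1+n m) (ℕₚ.≤-reflexive (cong suc (sym (ℕₚ.+-identityʳ m)))))))))

    assignments-complete : ∀ {ψ ds} → Pointwise ℕ._≤_ ψ ds → ψ ∈ assignments G ds
    assignments-complete []               = here refl
    assignments-complete {ds = _ ∷ ds} (p≤d ∷ ψ≤ds) =
      ∈ₚ.∈-concatMap⁺ (λ p → map (p ∷_) (assignments G ds)) (Any.map (λ { refl → ∈ₚ.∈-map⁺ _ (assignments-complete ψ≤ds) }) (∈ₚ.∈-upTo⁺ (s≤s p≤d)))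

    φ-≤-ψValue : ∀ {l ψ} → ψ ∈ assignments G (degList G) → sum ψ ≡ l →
                 ∃[ q ] φ G l ≡ just q × q ≤ ψValue G ψ
    φ-≤-ψValue {l} {ψ} = go (assignments G (degList G))
      where
      go : ∀ ψs → ψ ∈ ψs → sum ψ ≡ l →
           ∃[ q ] foldr (λ ψ′ acc → if sum ψ′ ≡ᵇ l then minMaybe G acc (ψValue G ψ′) else acc) nothing ψs ≡ just q
                  × q ≤ ψValue G ψ
      go (_ ∷ ψs) (here refl) refl rewrite ≡ᵇ-refl (sum ψ)
        with foldr (λ ψ′ acc → if sum ψ′ ≡ᵇ sum ψ then minMaybe G acc (ψValue G ψ′) else acc) nothing ψs
      ... | nothing = _ , refl , ℚₚ.≤-refl
      ... | just p  = _ , refl , ℚₚ.p⊓q≤q p _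
      go (ψ′ ∷ ψs) (there ψ∈ψs) sψ≡l with go ψs ψ∈ψs sψ≡l
      ... | q , eq , q≤ with sum ψ′ ≡ᵇ l
      ...   | false = q , eq , q≤
      ...   | true rewrite eq = _ , refl , ℚₚ.≤-trans (ℚₚ.p⊓q≤p q _) q≤

    1≤αHR : 1 ℕ.≤ αHR G
    1≤αHR = firstWith-pos (map suc (upTo (suc (numEdges G)))) (allSuc (upTo (suc (numEdges G))))
      where
      allSuc : ∀ ks → All (1 ℕ.≤_) (map suc ks)
      allSuc []       = []
      allSuc (k ∷ ks) = s≤s z≤n ∷ allSuc ks
      firstWith-pos : ∀ ks → All (1 ℕ.≤_) ks → 1 ℕ.≤ firstWith G (hrTest G) ks (suc (numEdges G))
      firstWith-pos []       []         = s≤s z≤n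
      firstWith-pos (k ∷ ks) (1≤k ∷ 1≤ks) with hrTest G k
      ... | true  = 1≤k
      ... | false = firstWith-pos ks 1≤ks

    hrTest2⇒αHR≤2 : hrTest G 2 ≡ true → αHR G ℕ.≤ 2
    hrTest2⇒αHR≤2 hr2 with numEdges G | hrTest G 1
    ... | zero  | true  = s≤s z≤n
    ... | zero  | false = s≤s z≤n
    ... | suc _ | true  = s≤s z≤n
    ... | suc _ | false rewrite hr2 = s≤s (s≤s z≤n)

    ψValue≤2⇒hrTest2 : ∀ {ψ} → ψ ∈ assignments G (degList G) → sum ψ ≡ 2 → ψValue G ψ ≤ fromℕ 2 → hrTest G 2 ≡ true
    ψValue≤2⇒hrTest2 ψ∈ sψ≡2 ψ≤2 with φ-≤-ψValue ψ∈ sψ≡2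
    ... | q , φ≡q , q≤ with φ G 2 | φ≡q
    ...   | .(just q) | refl = Equivalence.to Boolₚ.T-≡ (ℚₚ.≤⇒≤ᵇ (ℚₚ.≤-trans q≤ ψ≤2))

    αHR≤2-byDegrees : ∀ {d₁ d₂ ds} → degList G ≡ suc d₁ ∷ suc d₂ ∷ ds →
                      1/[1+ d₁ ] + (1/[1+ d₂ ] + sumQ (map 1/[1+_] ds)) ≤ fromℕ 2 → αHR G ℕ.≤ 2
    αHR≤2-byDegrees {d₁} {d₂} {ds} degs bound = hrTest2⇒αHR≤2 (ψValue≤2⇒hrTest2 ψ∈ sψ≡2 ψ≤2)
      where
      zeros : List ℕ → List ℕ
      zeros = map (λ _ → 0)
      ψ : List ℕ
      ψ = 1 ∷ 1 ∷ zeros ds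
      zeros≤ : ∀ ds → Pointwise ℕ._≤_ (zeros ds) ds
      zeros≤ []       = []
      zeros≤ (_ ∷ ds) = z≤n ∷ zeros≤ ds
      sum-zeros : ∀ ds → sum (zeros ds) ≡ 0
      sum-zeros []       = refl
      sum-zeros (_ ∷ ds) = sum-zeros ds
      zipWith-zeros : ∀ ds → zipWith (λ d p → 1/[1+ d ∸ p ]) ds (zeros ds) ≡ map 1/[1+_] ds
      zipWith-zeros []       = refl
      zipWith-zeros (d ∷ ds) = cong (1/[1+ d ] ∷_) (zipWith-zeros ds)
      ψ∈ : ψ ∈ assignments G (degList G)
      ψ∈ = subst (λ ds′ → ψ ∈ assignments G ds′) (sym degs) (assignments-complete {ds = suc d₁ ∷ suc d₂ ∷ ds} (s≤s z≤n ∷ s≤s z≤n ∷ zeros≤ ds))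
      sψ≡2 : sum ψ ≡ 2
      sψ≡2 = cong (λ k → 1 ℕ.+ (1 ℕ.+ k)) (sum-zeros ds)
      ψ≤2 : ψValue G ψ ≤ fromℕ 2
      ψ≤2 = subst (λ ds′ → sumQ (zipWith (λ d p → 1/[1+ d ∸ p ]) ds′ ψ) ≤ fromℕ 2) (sym degs)
              (subst (λ xs → 1/[1+ d₁ ] + (1/[1+ d₂ ] + sumQ xs) ≤ fromℕ 2) (sym (zipWith-zeros ds)) bound)

    minDeg≤deg : ∀ u → minDeg G ℕ.≤ deg G u
    minDeg≤deg u = foldr-⊓-≤ (deg G) n (∈ₚ.∈-allFin u)

    hmTerm≤αHM : ∀ t′ → t′ ℕ.< n ∸ minDeg G ∸ 1 → hmTerm G (2 ℕ.+ t′) ≤ αHM G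
    hmTerm≤αHM t′ t′<range = foldr-⊔-≥ (λ i → hmTerm G (2 ℕ.+ i)) (hmTerm G 2) (∈ₚ.∈-upTo⁺ t′<range)

open GeneralBounds

module Binomials where

  open import Data.Nat as ℕ using (ℕ; zero; suc; _+_; _*_; _∸_; _≤_; s≤s; z≤n)
  import Data.Nat.Properties as ℕₚ
  open import Data.Nat.Combinatorics using (_C_; k>n⇒nCk≡0; nC1≡n; nCk+nC[k+1]≡[n+1]C[k+1])
  open import Data.Nat.Tactic.RingSolver using (solve-∀)
  open import Relation.Binary.PropositionalEquality

  [1+k]*[1+m]C[1+k]≡[1+m]*mCk : ∀ m k → suc k * (suc m C suc k) ≡ suc m * (m C k)
  [1+k]*[1+m]C[1+k]≡[1+m]*mCk zero zero = refl
  [1+k]*[1+m]C[1+k]≡[1+m]*mCk zero (suc k)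
    rewrite k>n⇒nCk≡0 {1} {suc (suc k)} (s≤s (s≤s z≤n)) | ℕₚ.*-zeroʳ (suc (suc k)) = refl
  [1+k]*[1+m]C[1+k]≡[1+m]*mCk (suc m) zero = trans (ℕₚ.*-identityˡ _) (trans (nC1≡n (suc (suc m))) (sym (ℕₚ.*-identityʳ _)))
  [1+k]*[1+m]C[1+k]≡[1+m]*mCk (suc m) (suc k) = begin
    suc (suc k) * (suc (suc m) C suc (suc k))
      ≡⟨ cong (suc (suc k) *_) (sym (nCk+nC[k+1]≡[n+1]C[k+1] (suc m) (suc k))) ⟩
    suc (suc k) * (P + Q)
      ≡⟨ expand k P Q ⟩
    P + (suc k * P + suc (suc k) * Q)
      ≡⟨ cong (λ x → P + x) (cong₂ _+_ ([1+k]*[1+m]C[1+k]≡[1+m]*mCk m k) ([1+k]*[1+m]C[1+k]≡[1+m]*mCk m (suc k))) ⟩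
    P + (suc m * (m C k) + suc m * (m C suc k))
      ≡⟨ cong (λ x → P + x) (sym (ℕₚ.*-distribˡ-+ (suc m) (m C k) (m C suc k))) ⟩
    P + suc m * (m C k + m C suc k)
      ≡⟨ cong (λ x → P + suc m * x) (nCk+nC[k+1]≡[n+1]C[k+1] m k) ⟩
    P + suc m * P
      ≡⟨⟩
    suc (suc m) * P ∎
    where
    open ≡-Reasoning
    P : ℕ
    P = suc m C suc k
    Q : ℕ
    Q = suc m C suc (suc k)
    expand : ∀ k P Q → suc (suc k) * (P + Q) ≡ P + (suc k * P + suc (suc k) * Q)
    expand = solve-∀

  nCk≤[1+n]Ck : ∀ n k → n C k ≤ suc n C k
  nCk≤[1+n]Ck n zero    = ℕₚ.≤-refl
  nCk≤[1+n]Ck n (suc k) = ℕₚ.≤-trans (ℕₚ.m≤n+m (n C suc k) (n C k)) (ℕₚ.≤-reflexive (nCk+nC[k+1]≡[n+1]C[k+1] n k))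

  k≤n⇒1≤nCk : ∀ {n k} → k ≤ n → 1 ≤ n C k
  k≤n⇒1≤nCk {n}     {zero}  _         = s≤s z≤n
  k≤n⇒1≤nCk {suc n} {suc k} (s≤s k≤n) = ℕₚ.≤-trans (k≤n⇒1≤nCk k≤n)
    (ℕₚ.≤-trans (ℕₚ.m≤m+n (n C k) (n C suc k)) (ℕₚ.≤-reflexive (nCk+nC[k+1]≡[n+1]C[k+1] n k)))

  private
    nCr-ratio-+ : ∀ r e → let n = r * (r + 2) + e in n * (n C r) ≤ (r + 2) * (n C suc r)
    nCr-ratio-+ r e = ℕₚ.*-cancelˡ-≤ (suc r) (ℕₚ.+-cancelʳ-≤ ((r + 2) * (suc r * C₁)) _ _ (begin
      suc r * (n′ * C₁) + (r + 2) * (suc r * C₁)           ≤⟨ ℕₚ.m≤m+n _ (e * C₁) ⟩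
      suc r * (n′ * C₁) + (r + 2) * (suc r * C₁) + e * C₁  ≡⟨ regroup r e C₁ ⟩
      (r + 2) * (suc n′ * C₁)                              ≡⟨ cong ((r + 2) *_) (sym pascal-absorb) ⟩
      (r + 2) * (suc r * (C₁ + C₂))                       ≡⟨ distribute r C₁ C₂ ⟩
      suc r * ((r + 2) * C₂) + (r + 2) * (suc r * C₁)     ∎))
      where
      open ℕₚ.≤-Reasoning
      n′ : ℕ
      n′ = r * (r + 2) + e
      C₁ : ℕ
      C₁ = n′ C r
      C₂ : ℕ
      C₂ = n′ C suc r
      pascal-absorb : suc r * (C₁ + C₂) ≡ suc n′ * C₁
      pascal-absorb = trans (cong (suc r *_) (nCk+nC[k+1]≡[n+1]C[k+1] n′ r)) ([1+k]*[1+m]C[1+k]≡[1+m]*mCk n′ r)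
      regroup : ∀ r e c → suc r * ((r * (r + 2) + e) * c) + (r + 2) * (suc r * c) + e * c
                          ≡ (r + 2) * (suc (r * (r + 2) + e) * c)
      regroup = solve-∀
      distribute : ∀ r c₁ c₂ → (r + 2) * (suc r * (c₁ + c₂)) ≡ suc r * ((r + 2) * c₂) + (r + 2) * (suc r * c₁)
      distribute = solve-∀

  -- Since (r+1)·C(n,r+1) = (n−r)·C(n,r), the claim is (r+1)n ≤ (r+2)(n−r), i.e. r(r+2) ≤ n.
  nCr-ratio : ∀ r n → r * (r + 2) ≤ n → n * (n C r) ≤ (r + 2) * (n C suc r)
  nCr-ratio r n rr≤n =
    subst (λ n → n * (n C r) ≤ (r + 2) * (n C suc r)) (ℕₚ.m+[n∸m]≡n rr≤n) (nCr-ratio-+ r (n ∸ r * (r + 2)))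

  hmRatio≤ : ∀ r m → r * (r + 2) ≤ suc m →
             suc m * (suc m C r + suc m C r ∸ m C r) ≤ (r + 3) * (suc m C suc r)
  hmRatio≤ r m rr≤n = begin
    suc m * (C₁ + C₁ ∸ C₀)              ≡⟨ ℕₚ.*-distribˡ-∸ (suc m) (C₁ + C₁) C₀ ⟩
    suc m * (C₁ + C₁) ∸ suc m * C₀      ≡⟨ cong₂ _∸_ (ℕₚ.*-distribˡ-+ (suc m) C₁ C₁) (sym ([1+k]*[1+m]C[1+k]≡[1+m]*mCk m r)) ⟩
    (suc m * C₁ + suc m * C₁) ∸ suc r * K ≤⟨ ℕₚ.∸-monoˡ-≤ (suc r * K) (ℕₚ.+-mono-≤ ratio ratio) ⟩
    ((r + 2) * K + (r + 2) * K) ∸ suc r * K ≡⟨ cong (_∸ suc r * K) (regroup r K) ⟩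
    ((r + 3) * K + suc r * K) ∸ suc r * K ≡⟨ ℕₚ.m+n∸n≡m ((r + 3) * K) (suc r * K) ⟩
    (r + 3) * K                         ∎
    where
    open ℕₚ.≤-Reasoning
    C₀ : ℕ
    C₀ = m C r
    C₁ : ℕ
    C₁ = suc m C r
    K : ℕ
    K = suc m C suc r
    ratio : suc m * (suc m C r) ≤ (r + 2) * (suc m C suc r)
    ratio = nCr-ratio r (suc m) rr≤n
    regroup : ∀ r k → (r + 2) * k + (r + 2) * k ≡ (r + 3) * k + suc r * k
    regroup = solve-∀

open Binomials

module SplitGraphs where

  open import Data.Bool using (Bool; true; false; _∧_; _∨_; not; if_then_else_)
  import Data.Bool.Properties as Boolₚ
  open import Data.Nat as ℕ using (ℕ; zero; suc; _+_; _*_; _∸_; _<ᵇ_; _≡ᵇ_; _≤_; _<_; z≤n; s≤s; pred)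
  import Data.Nat.Properties as ℕₚ
  open import Data.Nat.Combinatorics using (_C_)
  open import Data.Nat.ListAction using (sum)
  open import Data.Nat.ListAction.Properties using (sum-++)
  open import Data.Integer as ℤ using (ℤ)
  open import Data.Fin as Fin using (Fin; toℕ; fromℕ<)
  open import Data.Fin.Properties using (toℕ<n; toℕ-injective; toℕ-fromℕ<)
  open import Data.List using (map; applyUpTo; allFin; _++_; replicate)
  import Data.List.Properties as Listₚ
  open import Function using (_∘_)
  open import Relation.Binary.PropositionalEquality
  open import Relation.Nullary using (yes; no)
  open import Data.Product using (_×_; _,_)

  private variable X : Set

  splitAdj : ℕ → ℕ → ℕ → Bool
  splitAdj N i j = ((i <ᵇ N) ∨ (j <ᵇ N)) ∧ not (i ≡ᵇ j)

  splitGraph : ∀ N s → Graph (N + s)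
  splitGraph N s = record
    { adj    = λ u v → splitAdj N (toℕ u) (toℕ v)
    ; sym    = λ u v → cong₂ (λ x y → x ∧ not y) (Boolₚ.∨-comm (toℕ u <ᵇ N) (toℕ v <ᵇ N)) (≡ᵇ-sym (toℕ u) (toℕ v))
    ; irrefl = λ u → trans (cong (λ y → ((toℕ u <ᵇ N) ∨ (toℕ u <ᵇ N)) ∧ not y) (≡ᵇ-refl (toℕ u))) (Boolₚ.∧-zeroʳ _)
    }

  module _ {N : ℕ} where

    splitAdj-clique : ∀ {i j} → i < N → i ≢ j → splitAdj N i j ≡ true
    splitAdj-clique i<N i≢j rewrite <ᵇ-true i<N | ≡ᵇ-false i≢j = refl

    splitAdj-indep-clique : ∀ {i j} → N ≤ i → j < N → splitAdj N i j ≡ true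
    splitAdj-indep-clique {i} {j} N≤i j<N
      rewrite <ᵇ-false N≤i | <ᵇ-true j<N | ≡ᵇ-false (<⇒≢ (ℕₚ.<-≤-trans j<N N≤i) ∘ sym) = refl

    splitAdj-indep-indep : ∀ {i j} → N ≤ i → N ≤ j → splitAdj N i j ≡ false
    splitAdj-indep-indep N≤i N≤j rewrite <ᵇ-false N≤i | <ᵇ-false N≤j = refl

  module _ (N s : ℕ) where

    private
      degAt : ℕ → ℕ
      degAt i = count (applyUpTo (splitAdj N i) (N + s))

    deg-splitGraph : ∀ u → deg (splitGraph N s) u ≡ degAt (toℕ u)
    deg-splitGraph u = cong count (map-toℕ-allFin (N + s) (splitAdj N (toℕ u)))

    degAt-clique : ∀ {i} → i < N → degAt i ≡ pred N + s
    degAt-clique {i} i<N = begin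
      degAt i
        ≡⟨ count-applyUpTo-+ (splitAdj N i) N s ⟩
      count (applyUpTo (splitAdj N i) N) + count (applyUpTo (λ j → splitAdj N i (N + j)) s)
        ≡⟨ cong₂ _+_ (cong count (applyUpTo-cong N (λ j → cong (λ x → (x ∨ (j <ᵇ N)) ∧ not (i ≡ᵇ j)) (<ᵇ-true i<N))))
                     (count-applyUpTo-true s (λ j _ → splitAdj-clique i<N (<⇒≢ (ℕₚ.<-≤-trans i<N (ℕₚ.m≤m+n N j))))) ⟩
      count (applyUpTo (λ j → not (i ≡ᵇ j)) N) + s
        ≡⟨ cong (_+ s) (count-≢ᵇ N i<N) ⟩
      pred N + s ∎
      where open ≡-Reasoning

    degAt-indep : ∀ {i} → N ≤ i → degAt i ≡ N
    degAt-indep {i} N≤i = begin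
      degAt i
        ≡⟨ count-applyUpTo-+ (splitAdj N i) N s ⟩
      count (applyUpTo (splitAdj N i) N) + count (applyUpTo (λ j → splitAdj N i (N + j)) s)
        ≡⟨ cong₂ _+_ (count-applyUpTo-true N (λ j j<N → splitAdj-indep-clique N≤i j<N))
                     (count-applyUpTo-false s (λ j _ → splitAdj-indep-indep N≤i (ℕₚ.m≤m+n N j))) ⟩
      N + 0 ≡⟨ ℕₚ.+-identityʳ N ⟩
      N ∎
      where open ≡-Reasoning

    degList-splitGraph : degList (splitGraph N s) ≡ replicate N (pred N + s) ++ replicate s N
    degList-splitGraph = begin
      map (deg (splitGraph N s)) (allFin (N + s))
        ≡⟨ Listₚ.map-cong deg-splitGraph (allFin (N + s)) ⟩
      map (degAt ∘ toℕ) (allFin (N + s))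
        ≡⟨ map-toℕ-allFin (N + s) degAt ⟩
      applyUpTo degAt (N + s)
        ≡⟨ applyUpTo-+ degAt N s ⟩
      applyUpTo degAt N ++ applyUpTo (λ j → degAt (N + j)) s
        ≡⟨ cong₂ _++_ (applyUpTo-replicate N (λ j → degAt-clique))
                      (applyUpTo-replicate s (λ j _ → degAt-indep (ℕₚ.m≤m+n N j))) ⟩
      replicate N (pred N + s) ++ replicate s N ∎
      where open ≡-Reasoning

    deg-splitGraph-indep : ∀ u → N ≤ toℕ u → deg (splitGraph N s) u ≡ N
    deg-splitGraph-indep u N≤u = trans (deg-splitGraph u) (degAt-indep N≤u)

    closedUnion-splitGraph-indep : ∀ u v → N ≤ toℕ u → N ≤ toℕ v → u ≢ v → closedUnion (splitGraph N s) u v ≡ N + 2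
    closedUnion-splitGraph-indep u v N≤u N≤v u≢v = begin
      closedUnion (splitGraph N s) u v
        ≡⟨ cong count (map-toℕ-allFin (N + s) P) ⟩
      count (applyUpTo P (N + s))
        ≡⟨ count-applyUpTo-+ P N s ⟩
      count (applyUpTo P N) + count (applyUpTo (λ k → P (N + k)) s)
        ≡⟨ cong₂ _+_ (count-applyUpTo-true N (λ k k<N → trans
                        (cong (λ x → (k ≡ᵇ i) ∨ x ∨ (k ≡ᵇ j) ∨ splitAdj N j k) (splitAdj-indep-clique N≤u k<N))
                        (Boolₚ.∨-zeroʳ (k ≡ᵇ i))))
                     (trans (cong count (applyUpTo-cong s P[N+k])) (count-≡ᵇ-∨ s i′≢j′ i′<s j′<s)) ⟩
      N + 2 ∎
      where
      open ≡-Reasoning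
      i : ℕ
      i = toℕ u
      j : ℕ
      j = toℕ v
      i′ : ℕ
      i′ = i ∸ N
      j′ : ℕ
      j′ = j ∸ N
      P : ℕ → Bool
      P k = (k ≡ᵇ i) ∨ splitAdj N i k ∨ (k ≡ᵇ j) ∨ splitAdj N j k
      N+i′≡i : N + i′ ≡ i
      N+i′≡i = ℕₚ.m+[n∸m]≡n N≤u
      N+j′≡j : N + j′ ≡ j
      N+j′≡j = ℕₚ.m+[n∸m]≡n N≤v
      i′≢j′ : i′ ≢ j′
      i′≢j′ e = u≢v (toℕ-injective (trans (sym N+i′≡i) (trans (cong (N +_) e) N+j′≡j)))
      i′<s : i′ < s
      i′<s = ℕₚ.+-cancelˡ-< N i′ s (subst (_< N + s) (sym N+i′≡i) (toℕ<n u))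
      j′<s : j′ < s
      j′<s = ℕₚ.+-cancelˡ-< N j′ s (subst (_< N + s) (sym N+j′≡j) (toℕ<n v))
      P[N+k] : ∀ k → P (N + k) ≡ (k ≡ᵇ i′) ∨ (k ≡ᵇ j′)
      P[N+k] k = begin
        P (N + k)
          ≡⟨ cong₂ (λ x y → ((N + k) ≡ᵇ i) ∨ x ∨ ((N + k) ≡ᵇ j) ∨ y)
                   (splitAdj-indep-indep N≤u (ℕₚ.m≤m+n N k)) (splitAdj-indep-indep N≤v (ℕₚ.m≤m+n N k)) ⟩
        ((N + k) ≡ᵇ i) ∨ false ∨ ((N + k) ≡ᵇ j) ∨ false
          ≡⟨ cong₂ (λ x y → (N + k ≡ᵇ x) ∨ false ∨ (N + k ≡ᵇ y) ∨ false) (sym N+i′≡i) (sym N+j′≡j) ⟩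
        ((N + k) ≡ᵇ (N + i′)) ∨ false ∨ ((N + k) ≡ᵇ (N + j′)) ∨ false
          ≡⟨ cong₂ (λ x y → x ∨ y ∨ false) (+-cancelˡ-≡ᵇ N k i′) (+-cancelˡ-≡ᵇ N k j′) ⟩
        (k ≡ᵇ i′) ∨ (k ≡ᵇ j′) ∨ false
          ≡⟨ cong ((k ≡ᵇ i′) ∨_) (Boolₚ.∨-identityʳ (k ≡ᵇ j′)) ⟩
        (k ≡ᵇ i′) ∨ (k ≡ᵇ j′) ∎

    nonEdge-splitAdj : ∀ i j → (i <ᵇ j) ∧ (if splitAdj N i j then false else true) ≡ (i <ᵇ j) ∧ not (i <ᵇ N)
    nonEdge-splitAdj i j with i <ᵇ j in i<ᵇj | i ℕₚ.<? N
    ... | false | _       = refl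
    ... | true  | yes i<N rewrite splitAdj-clique {j = j} i<N (<⇒≢ (<ᵇ-true⁻¹ i<ᵇj)) | <ᵇ-true i<N = refl
    ... | true  | no  i≮N rewrite splitAdj-indep-indep {j = j} (ℕₚ.≮⇒≥ i≮N) (ℕₚ.≤-trans (ℕₚ.≮⇒≥ i≮N) (ℕₚ.<⇒≤ (<ᵇ-true⁻¹ i<ᵇj)))
                                | <ᵇ-false (ℕₚ.≮⇒≥ i≮N) = refl

    private
      indepPair : ℕ → ℕ → Bool
      indepPair i j = (i <ᵇ j) ∧ not (i <ᵇ N)

      indepPair-true : ∀ {i j} → indepPair i j ≡ true → i < j × N ≤ i
      indepPair-true {i} {j} with i <ᵇ j in i<ᵇj | i <ᵇ N in i<ᵇN
      ... | true  | false = λ _ → <ᵇ-true⁻¹ i<ᵇj , <ᵇ-false⁻¹ i<ᵇN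
      ... | true  | true  = λ ()
      ... | false | _     = λ ()

      indepPairCount : ℕ → ℕ
      indepPairCount i = count (applyUpTo (indepPair i) (N + s))

      sum-indepPairCount : sum (applyUpTo indepPairCount (N + s)) ≡ pairCount s
      sum-indepPairCount = begin
        sum (applyUpTo indepPairCount (N + s))
          ≡⟨ cong sum (applyUpTo-+ indepPairCount N s) ⟩
        sum (applyUpTo indepPairCount N ++ applyUpTo (λ k → indepPairCount (N + k)) s)
          ≡⟨ sum-++ (applyUpTo indepPairCount N) _ ⟩
        sum (applyUpTo indepPairCount N) + sum (applyUpTo (λ k → indepPairCount (N + k)) s)
          ≡⟨ cong₂ _+_ (cong sum (applyUpTo-replicate N (λ i i<N → clique-row i<N)))
                       (cong sum (applyUpTo-cong s indep-row)) ⟩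
        sum (replicate N 0) + pairCount s
          ≡⟨ cong (_+ pairCount s) (trans (sum-replicate N 0) (ℕₚ.*-zeroʳ N)) ⟩
        pairCount s ∎
        where
        open ≡-Reasoning
        clique-row : ∀ {i} → i < N → indepPairCount i ≡ 0
        clique-row {i} i<N = count-applyUpTo-false (N + s) (λ j _ →
          trans (cong (λ x → (i <ᵇ j) ∧ not x) (<ᵇ-true i<N)) (Boolₚ.∧-zeroʳ (i <ᵇ j)))
        indep-row : ∀ k → indepPairCount (N + k) ≡ s ∸ suc k
        indep-row k = begin
          count (applyUpTo (indepPair (N + k)) (N + s))
            ≡⟨ cong count (applyUpTo-cong (N + s) (λ j →
                 trans (cong (λ x → (N + k <ᵇ j) ∧ not x) (<ᵇ-false (ℕₚ.m≤m+n N k))) (Boolₚ.∧-identityʳ _))) ⟩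
          count (applyUpTo (N + k <ᵇ_) (N + s))
            ≡⟨ count-applyUpTo-+ (N + k <ᵇ_) N s ⟩
          count (applyUpTo (N + k <ᵇ_) N) + count (applyUpTo (λ j → N + k <ᵇ N + j) s)
            ≡⟨ cong₂ _+_ (count-applyUpTo-false N (λ j j<N → <ᵇ-false (ℕₚ.≤-trans (ℕₚ.<⇒≤ j<N) (ℕₚ.m≤m+n N k))))
                         (trans (cong count (applyUpTo-cong s (+-cancelˡ-<ᵇ N k))) (count-<ᵇ k s)) ⟩
          s ∸ suc k ∎

    nonEdgeWeight : ℕ → ℤ
    nonEdgeWeight t = (ℤ.+ ((s ∸ 1) C (t ∸ 2)) ℤ.+ ℤ.+ ((s ∸ 1) C (t ∸ 2))) ℤ.- ℤ.+ ((s ∸ 2) C (t ∸ 2))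

    -- The non-edges are exactly the pairs inside the independent set, and all of
    -- them contribute the same weight.
    b-splitGraph : ∀ t → b (splitGraph N s) t ≡ ℤ.+ 2 ℤ.* (ℤ.+ pairCount s ℤ.* nonEdgeWeight t)
    b-splitGraph t = cong (ℤ.+ 2 ℤ.*_) (begin
      sumℤ (map (λ u → sumℤ (map (F u) (allFin (N + s)))) (allFin (N + s)))
        ≡⟨ cong sumℤ (Listₚ.map-cong (λ u → cong sumℤ (Listₚ.map-cong (summand u) (allFin (N + s)))) (allFin (N + s))) ⟩
      sumℤ (map (λ u → sumℤ (map (λ v → if indepPair (toℕ u) (toℕ v) then W else ℤ.+ 0) (allFin (N + s)))) (allFin (N + s)))
        ≡⟨ cong sumℤ (Listₚ.map-cong (λ u → trans (sumℤ-if (indepPair (toℕ u) ∘ toℕ) W (allFin (N + s)))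
                                                  (cong (λ xs → ℤ.+ count xs ℤ.* W) (map-toℕ-allFin (N + s) (indepPair (toℕ u)))))
                                     (allFin (N + s))) ⟩
      sumℤ (map (λ u → ℤ.+ indepPairCount (toℕ u) ℤ.* W) (allFin (N + s)))
        ≡⟨ sumℤ-*ʳ (indepPairCount ∘ toℕ) W (allFin (N + s)) ⟩
      ℤ.+ sum (map (indepPairCount ∘ toℕ) (allFin (N + s))) ℤ.* W
        ≡⟨ cong (λ k → ℤ.+ k ℤ.* W) (trans (cong sum (map-toℕ-allFin (N + s) indepPairCount)) sum-indepPairCount) ⟩
      ℤ.+ pairCount s ℤ.* W ∎)
      where
      open ≡-Reasoning
      G : Graph (N + s)
      G = splitGraph N s
      W : ℤ
      W = nonEdgeWeight t
      F : Fin (N + s) → Fin (N + s) → ℤ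
      F u v = if (toℕ u <ᵇ toℕ v) ∧ (if adj G u v then false else true)
              then (ℤ.+ ((N + s ∸ deg G u ∸ 1) C (t ∸ 2)) ℤ.+ ℤ.+ ((N + s ∸ deg G v ∸ 1) C (t ∸ 2))
                    ℤ.- ℤ.+ ((N + s ∸ closedUnion G u v) C (t ∸ 2)))
              else ℤ.+ 0
      summand : ∀ u v → F u v ≡ (if indepPair (toℕ u) (toℕ v) then W else ℤ.+ 0)
      summand u v = if-cong (nonEdge-splitAdj (toℕ u) (toℕ v)) weight
        where
        weight : indepPair (toℕ u) (toℕ v) ≡ true →
                 (ℤ.+ ((N + s ∸ deg G u ∸ 1) C (t ∸ 2)) ℤ.+ ℤ.+ ((N + s ∸ deg G v ∸ 1) C (t ∸ 2)))
                   ℤ.- ℤ.+ ((N + s ∸ closedUnion G u v) C (t ∸ 2)) ≡ W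
        weight indep with indepPair-true indep
        ... | u<v , N≤u
          rewrite deg-splitGraph-indep u N≤u
                | deg-splitGraph-indep v (ℕₚ.≤-trans N≤u (ℕₚ.<⇒≤ u<v))
                | closedUnion-splitGraph-indep u v N≤u (ℕₚ.≤-trans N≤u (ℕₚ.<⇒≤ u<v)) (λ { refl → ℕₚ.<-irrefl refl u<v })
                | ℕₚ.m+n∸m≡n N s
                | ℕₚ.[m+n]∸[m+o]≡n∸o N s 2 = refl

  a-splitGraph : ∀ N′ s t′ → a (splitGraph (suc N′) s) (2 + t′) ≡ s * ((s ∸ 1) C suc t′)
  a-splitGraph N′ s t′ = begin
    sum (map (h ∘ deg (splitGraph N s)) (allFin (N + s)))
      ≡⟨ cong sum (Listₚ.map-∘ (allFin (N + s))) ⟩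
    sum (map h (degList (splitGraph N s)))
      ≡⟨ cong (sum ∘ map h) (degList-splitGraph N s) ⟩
    sum (map h (replicate N (N′ + s) ++ replicate s N))
      ≡⟨ cong sum (Listₚ.map-++ h (replicate N (N′ + s)) (replicate s N)) ⟩
    sum (map h (replicate N (N′ + s)) ++ map h (replicate s N))
      ≡⟨ sum-++ (map h (replicate N (N′ + s))) _ ⟩
    sum (map h (replicate N (N′ + s))) + sum (map h (replicate s N))
      ≡⟨ cong₂ _+_ (cong sum (Listₚ.map-replicate h N (N′ + s))) (cong sum (Listₚ.map-replicate h s N)) ⟩
    sum (replicate N (h (N′ + s))) + sum (replicate s (h N))
      ≡⟨ cong₂ _+_ (sum-replicate N _) (sum-replicate s _) ⟩
    N * h (N′ + s) + s * h N
      ≡⟨ cong₂ (λ x y → N * x + s * y) h[clique] h[indep] ⟩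
    N * 0 + s * ((s ∸ 1) C suc t′)
      ≡⟨ cong (_+ s * ((s ∸ 1) C suc t′)) (ℕₚ.*-zeroʳ N) ⟩
    s * ((s ∸ 1) C suc t′) ∎
    where
    open ≡-Reasoning
    N : ℕ
    N = suc N′
    h : ℕ → ℕ
    h d = (N + s ∸ d ∸ 1) C suc t′
    h[clique] : h (N′ + s) ≡ 0
    h[clique] = cong (λ x → (x ∸ 1) C suc t′) (ℕₚ.m+n∸n≡m 1 (N′ + s))
    h[indep] : h N ≡ (s ∸ 1) C suc t′
    h[indep] = cong (λ x → (x ∸ 1) C suc t′) (ℕₚ.m+n∸m≡n N s)

  _◅◅_ : ∀ {n} {G : Graph n} {u v w} → Walk G u v → Walk G v w → Walk G u w
  nil       ◅◅ q = q
  cons e p  ◅◅ q = cons e (p ◅◅ q)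

  reverseWalk : ∀ {n} {G : Graph n} {u v} → Walk G u v → Walk G v u
  reverseWalk         nil                  = nil
  reverseWalk {G = G} (cons {u} {w} e p) = reverseWalk p ◅◅ cons (trans (Graph.sym G w u) e) nil

  connected-viaHub : ∀ {n} (G : Graph n) (hub : Fin n) → (∀ u → Walk G u hub) → Connected G
  connected-viaHub G hub toHub u v = toHub u ◅◅ reverseWalk (toHub v)

  splitGraph-connected : ∀ N′ s → Connected (splitGraph (suc N′) s)
  splitGraph-connected N′ s = connected-viaHub _ Fin.zero toHub
    where
    toHub : ∀ u → Walk (splitGraph (suc N′) s) u Fin.zero
    toHub Fin.zero    = nil
    toHub (Fin.suc u) = cons (cong (_∧ true) (Boolₚ.∨-zeroʳ (suc (toℕ u) ℕ.<ᵇ suc N′))) nil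

  splitGraph-nonComplete : ∀ N s → 2 ≤ s → NonComplete (splitGraph N s)
  splitGraph-nonComplete N s 2≤s = fromℕ< N<N+s , fromℕ< N+1<N+s , N≢N+1 , not-adjacent
    where
    N<N+s : N < N + s
    N<N+s = ℕₚ.m<m+n N (ℕₚ.<-≤-trans (s≤s z≤n) 2≤s)
    N+1<N+s : suc N < N + s
    N+1<N+s = subst (_< N + s) (ℕₚ.+-comm N 1) (ℕₚ.+-monoʳ-< N 2≤s)
    N≢N+1 : fromℕ< N<N+s ≢ fromℕ< N+1<N+s
    N≢N+1 e = ℕₚ.1+n≢n (sym (trans (sym (toℕ-fromℕ< N<N+s)) (trans (cong toℕ e) (toℕ-fromℕ< N+1<N+s))))
    not-adjacent : adj (splitGraph N s) (fromℕ< N<N+s) (fromℕ< N+1<N+s) ≡ false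
    not-adjacent = splitAdj-indep-indep (ℕₚ.≤-reflexive (sym (toℕ-fromℕ< N<N+s)))
                                        (ℕₚ.≤-trans (ℕₚ.n≤1+n N) (ℕₚ.≤-reflexive (sym (toℕ-fromℕ< N+1<N+s))))

  splitΓ : ∀ N′ s → 2 ≤ s → ΓGraph
  splitΓ N′ s 2≤s = record
    { graph       = splitGraph (suc N′) s
    ; connected   = splitGraph-connected N′ s
    ; nonComplete = splitGraph-nonComplete (suc N′) s 2≤s
    }

open SplitGraphs

module UnboundedRatio where

  open import Data.Nat as ℕ using (ℕ; suc; s≤s; z≤n)
  import Data.Nat.Properties as ℕₚ
  open import Data.Nat.Combinatorics using (_C_)
  open import Data.Nat.Tactic.RingSolver using (solve-∀)
  open import Data.Integer as ℤ using (ℤ)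
  import Data.Integer.Properties as ℤₚ
  open import Data.Rational as ℚ using (ℚ; 0ℚ; 1ℚ; _≤_; _<_; _+_; _-_; _*_; _⊔_)
  import Data.Rational.Properties as ℚₚ
  open import Data.Fin using (fromℕ<)
  open import Data.Fin.Properties using (toℕ-fromℕ<)
  open import Data.List using (map; allFin; _++_; replicate)
  import Data.List.Properties as Listₚ
  open import Data.Product using (Σ; ∃; _,_)
  open import Function using (_∘_)
  open import Relation.Binary.PropositionalEquality

  αCW-byDegrees : ∀ {n} (G : Graph n) → αCW G ≡ sumQ (map 1/[1+_] (degList G))
  αCW-byDegrees {n} G = cong sumQ (Listₚ.map-∘ (allFin n))

  sumQ-1/[1+]-replicate : ∀ k x l y →
    sumQ (map 1/[1+_] (replicate k x ++ replicate l y)) ≡ fromℕ k * 1/[1+ x ] + fromℕ l * 1/[1+ y ]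
  sumQ-1/[1+]-replicate k x l y = begin
    sumQ (map 1/[1+_] (replicate k x ++ replicate l y))
      ≡⟨ cong sumQ (Listₚ.map-++ 1/[1+_] (replicate k x) (replicate l y)) ⟩
    sumQ (map 1/[1+_] (replicate k x) ++ map 1/[1+_] (replicate l y))
      ≡⟨ sumQ-++ (map 1/[1+_] (replicate k x)) _ ⟩
    sumQ (map 1/[1+_] (replicate k x)) + sumQ (map 1/[1+_] (replicate l y))
      ≡⟨ cong₂ _+_ (trans (cong sumQ (Listₚ.map-replicate 1/[1+_] k x)) (sumQ-replicate k _))
                   (trans (cong sumQ (Listₚ.map-replicate 1/[1+_] l y)) (sumQ-replicate l _)) ⟩
    fromℕ k * 1/[1+ x ] + fromℕ l * 1/[1+ y ] ∎
    where open ≡-Reasoning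

  -- The clique and the independent set both have s = 6 + R vertices. The offset 6
  -- makes the bounds on α_CW, α_S, α_ACL and α_HR uniform in R; the bound on α_HM
  -- needs r(r+2) ≤ R.
  module SplitFamily (R : ℕ) where

    s : ℕ
    s = 6 ℕ.+ R

    G : Graph (s ℕ.+ s)
    G = splitGraph s s

    Γ : ΓGraph
    Γ = splitΓ (5 ℕ.+ R) s (s≤s (s≤s z≤n))

    αCW≡ : αCW G ≡ 1 /suc 1 + s /suc s
    αCW≡ = begin
      αCW G                                               ≡⟨ αCW-byDegrees G ⟩
      sumQ (map 1/[1+_] (degList G))                      ≡⟨ cong (sumQ ∘ map 1/[1+_]) (degList-splitGraph s s) ⟩
      sumQ (map 1/[1+_] (replicate s (5 ℕ.+ R ℕ.+ s) ++ replicate s s)) ≡⟨ sumQ-1/[1+]-replicate s (5 ℕ.+ R ℕ.+ s) s s ⟩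
      fromℕ s * 1/[1+ 5 ℕ.+ R ℕ.+ s ] + fromℕ s * 1/[1+ s ] ≡⟨ cong₂ _+_ clique indep ⟩
      1 /suc 1 + s /suc s                                 ∎
      where
      open ≡-Reasoning
      clique : fromℕ s * 1/[1+ 5 ℕ.+ R ℕ.+ s ] ≡ 1 /suc 1
      clique = trans (/suc-* s 0 1 Q) (/suc-≡ (s ℕ.* 1) (Q ℕ.+ 0 ℕ.* suc Q) 1 1 (cross R))
        where
        Q : ℕ
        Q = 5 ℕ.+ R ℕ.+ s
        cross : ∀ R → (6 ℕ.+ R) ℕ.* 1 ℕ.* 2 ≡ 1 ℕ.* suc ((5 ℕ.+ R ℕ.+ (6 ℕ.+ R)) ℕ.+ 0 ℕ.* suc (5 ℕ.+ R ℕ.+ (6 ℕ.+ R)))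
        cross = solve-∀
      indep : fromℕ s * 1/[1+ s ] ≡ s /suc s
      indep = trans (/suc-* s 0 1 s) (/suc-≡ (s ℕ.* 1) (s ℕ.+ 0 ℕ.* suc s) s s (cross R))
        where
        cross : ∀ R → (6 ℕ.+ R) ℕ.* 1 ℕ.* suc (6 ℕ.+ R) ≡ (6 ℕ.+ R) ℕ.* suc ((6 ℕ.+ R) ℕ.+ 0 ℕ.* suc (6 ℕ.+ R))
        cross = solve-∀

    s/suc-s≡ : fromℕ s * 1/[1+ s ] ≡ s /suc s
    s/suc-s≡ = trans (/suc-* s 0 1 s) (/suc-≡ (s ℕ.* 1) (s ℕ.+ 0 ℕ.* suc s) s s (cross R))
      where
      cross : ∀ R → (6 ℕ.+ R) ℕ.* 1 ℕ.* suc (6 ℕ.+ R) ≡ (6 ℕ.+ R) ℕ.* suc ((6 ℕ.+ R) ℕ.+ 0 ℕ.* suc (6 ℕ.+ R))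
      cross = solve-∀

    αCW≤3/2 : αCW G ≤ 3 /suc 1
    αCW≤3/2 = subst (_≤ 3 /suc 1) (sym αCW≡) (ℚₚ.≤-trans (ℚₚ.+-monoʳ-≤ (1 /suc 1) (k/suc-k≤1 s)) (ℚₚ.≤ᵇ⇒≤ _))

    1/3≤αCW-1 : 1 /suc 2 ≤ αCW G - 1ℚ
    1/3≤αCW-1 = subst (λ x → 1 /suc 2 ≤ x - 1ℚ) (sym αCW≡)
      (ℚₚ.≤-trans (ℚₚ.≤ᵇ⇒≤ {1 /suc 2} {1 /suc 1 + 5 /suc 5 - 1ℚ} _)
                  (ℚₚ.+-monoˡ-≤ (ℚ.- 1ℚ) (ℚₚ.+-monoʳ-≤ (1 /suc 1) (/suc-≤ 5 5 s s (m+k≡n⇒m≤n (suc R) (cross R))))))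
      where
      cross : ∀ R → 5 ℕ.* suc (6 ℕ.+ R) ℕ.+ suc R ≡ (6 ℕ.+ R) ℕ.* 6
      cross = solve-∀

    αS≤3 : αS G ≤ fromℕ 3
    αS≤3 = ℚₚ.≤-trans (αS≤2αCW G) (ℚₚ.≤-trans (ℚₚ.+-mono-≤ αCW≤3/2 αCW≤3/2) (ℚₚ.≤ᵇ⇒≤ _))

    αACL≤20 : αACL G ≤ fromℕ 20
    αACL≤20 = ℚₚ.≤-trans (ℚₚ.+-mono-≤ αCW≤3/2 (divQ-≤ {A G} {αCW G - 1ℚ} {fromℕ 18} 0<αCW-1 A≤18[αCW-1])) (ℚₚ.≤ᵇ⇒≤ _)
      where
      0<αCW-1 : 0ℚ < αCW G - 1ℚ
      0<αCW-1 = ℚₚ.<-≤-trans (/suc-< 0 0 1 2 (s≤s z≤n)) 1/3≤αCW-1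
      A≤6 : A G ≤ fromℕ 6
      A≤6 = ℚₚ.≤-trans (A≤ G) (ℚₚ.≤-trans
        (ℚₚ.+-mono-≤ αCW≤3/2 (ℚₚ.≤-trans (*-monoʳ-≤-0≤ (αCW-0≤ G) (*-monoˡ-≤-0≤ (0≤/suc 2 0) αCW≤3/2))
                                          (*-monoˡ-≤-0≤ (ℚₚ.≤ᵇ⇒≤ {0ℚ} {fromℕ 2 * 3 /suc 1} _) αCW≤3/2)))
        (ℚₚ.≤ᵇ⇒≤ _))
      A≤18[αCW-1] : A G ≤ fromℕ 18 * (αCW G - 1ℚ)
      A≤18[αCW-1] = ℚₚ.≤-trans A≤6 (ℚₚ.≤-trans (ℚₚ.≤ᵇ⇒≤ {fromℕ 6} {fromℕ 18 * 1 /suc 2} _)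
                                               (*-monoˡ-≤-0≤ (0≤/suc 18 0) 1/3≤αCW-1))

    αHR≤2 : αHR G ℕ.≤ 2
    αHR≤2 = αHR≤2-byDegrees G (degList-splitGraph s s) (ℚₚ.≤-trans
      (ℚₚ.+-mono-≤ 1/[1+d]≤1/4 (ℚₚ.+-mono-≤ 1/[1+d]≤1/4
        (subst (_≤ 1 /suc 1 + 1ℚ) (sym (sumQ-1/[1+]-replicate (4 ℕ.+ R) (5 ℕ.+ R ℕ.+ s) s s))
          (ℚₚ.+-mono-≤ clique≤1/2 (subst (_≤ 1ℚ) (sym s/suc-s≡) (k/suc-k≤1 s))))))
      (ℚₚ.≤ᵇ⇒≤ _))
      where
      1/[1+d]≤1/4 : 1/[1+ 4 ℕ.+ R ℕ.+ s ] ≤ 1 /suc 3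
      1/[1+d]≤1/4 = /suc-≤ 1 (4 ℕ.+ R ℕ.+ s) 1 3 (m+k≡n⇒m≤n (suc (R ℕ.+ s)) (cross R))
        where
        cross : ∀ R → 1 ℕ.* 4 ℕ.+ suc (R ℕ.+ (6 ℕ.+ R)) ≡ 1 ℕ.* suc (4 ℕ.+ R ℕ.+ (6 ℕ.+ R))
        cross = solve-∀
      clique≤1/2 : fromℕ (4 ℕ.+ R) * 1/[1+ 5 ℕ.+ R ℕ.+ s ] ≤ 1 /suc 1
      clique≤1/2 = subst (_≤ 1 /suc 1) (sym (/suc-* (4 ℕ.+ R) 0 1 Q))
        (/suc-≤ ((4 ℕ.+ R) ℕ.* 1) (Q ℕ.+ 0 ℕ.* suc Q) 1 1 (m+k≡n⇒m≤n 4 (cross R)))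
        where
        Q : ℕ
        Q = 5 ℕ.+ R ℕ.+ s
        cross : ∀ R → (4 ℕ.+ R) ℕ.* 1 ℕ.* 2 ℕ.+ 4 ≡ 1 ℕ.* suc ((5 ℕ.+ R ℕ.+ (6 ℕ.+ R)) ℕ.+ 0 ℕ.* suc (5 ℕ.+ R ℕ.+ (6 ℕ.+ R)))
        cross = solve-∀

    module _ {r : ℕ} (rr≤R : r ℕ.* (r ℕ.+ 2) ℕ.≤ R) where

      private
        C₀ : ℕ
        C₀ = (4 ℕ.+ R) C r
        C₁ : ℕ
        C₁ = (5 ℕ.+ R) C r
        K : ℕ
        K = (5 ℕ.+ R) C suc r
        D : ℕ
        D = C₁ ℕ.+ C₁ ℕ.∸ C₀

        r≤R : r ℕ.≤ R
        r≤R = ℕₚ.≤-trans (m+k≡n⇒m≤n (r ℕ.* r ℕ.+ r) (cross r)) rr≤R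
          where
          cross : ∀ r → r ℕ.+ (r ℕ.* r ℕ.+ r) ≡ r ℕ.* (r ℕ.+ 2)
          cross = solve-∀

        b≡ : b G (2 ℕ.+ r) ≡ ℤ.+ (2 ℕ.* (pairCount s ℕ.* D))
        b≡ = trans (b-splitGraph s s (2 ℕ.+ r))
                   (trans (cong (λ w → ℤ.+ 2 ℤ.* (ℤ.+ pairCount s ℤ.* w)) weight≡)
                          (trans (cong (ℤ.+ 2 ℤ.*_) (sym (ℤₚ.pos-* (pairCount s) D))) (sym (ℤₚ.pos-* 2 (pairCount s ℕ.* D)))))
          where
          weight≡ : nonEdgeWeight s s (2 ℕ.+ r) ≡ ℤ.+ D
          weight≡ = trans (cong (ℤ._- ℤ.+ C₀) (sym (ℤₚ.pos-+ C₁ C₁)))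
                          (trans (ℤₚ.m-n≡m⊖n (C₁ ℕ.+ C₁) C₀)
                                 (ℤₚ.⊖-≥ (ℕₚ.≤-trans (nCk≤[1+n]Ck (4 ℕ.+ R) r) (ℕₚ.m≤m+n C₁ C₁))))

        b≤[r+3]a : 2 ℕ.* (pairCount s ℕ.* D) ℕ.≤ (r ℕ.+ 3) ℕ.* (s ℕ.* K)
        b≤[r+3]a = begin
          2 ℕ.* (pairCount s ℕ.* D)      ≡⟨ sym (ℕₚ.*-assoc 2 (pairCount s) D) ⟩
          2 ℕ.* pairCount s ℕ.* D        ≡⟨ cong (ℕ._* D) (*-2-pairCount s) ⟩
          s ℕ.* (5 ℕ.+ R) ℕ.* D          ≡⟨ ℕₚ.*-assoc s (5 ℕ.+ R) D ⟩
          s ℕ.* ((5 ℕ.+ R) ℕ.* D)        ≤⟨ ℕₚ.*-monoʳ-≤ s (hmRatio≤ r (4 ℕ.+ R) (ℕₚ.≤-trans rr≤R (ℕₚ.m≤n+m R 5))) ⟩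
          s ℕ.* ((r ℕ.+ 3) ℕ.* K)        ≡⟨ ℕₚ.*-comm s ((r ℕ.+ 3) ℕ.* K) ⟩
          (r ℕ.+ 3) ℕ.* K ℕ.* s          ≡⟨ ℕₚ.*-assoc (r ℕ.+ 3) K s ⟩
          (r ℕ.+ 3) ℕ.* (K ℕ.* s)        ≡⟨ cong ((r ℕ.+ 3) ℕ.*_) (ℕₚ.*-comm K s) ⟩
          (r ℕ.+ 3) ℕ.* (s ℕ.* K)        ∎
          where open ℕₚ.≤-Reasoning

        0<sK : 0ℚ < fromℕ (s ℕ.* K)
        0<sK = fromℕ-mono-< (ℕₚ.*-mono-≤ {1} {s} (s≤s z≤n) (k≤n⇒1≤nCk (ℕₚ.≤-trans (s≤s r≤R) (ℕₚ.m≤n+m (suc R) 4))))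

      b/a≤r+3 : divQ (fromℤ (b G (2 ℕ.+ r))) (fromℕ (a G (2 ℕ.+ r))) ≤ fromℕ (r ℕ.+ 3)
      b/a≤r+3 = subst₂ (λ x y → divQ (fromℤ x) (fromℕ y) ≤ fromℕ (r ℕ.+ 3)) (sym b≡) (sym (a-splitGraph (5 ℕ.+ R) s r))
        (divQ-≤ {fromℕ (2 ℕ.* (pairCount s ℕ.* D))} {fromℕ (s ℕ.* K)} {fromℕ (r ℕ.+ 3)} 0<sK
          (ℚₚ.≤-trans (fromℕ-mono-≤ b≤[r+3]a) (ℚₚ.≤-reflexive (sym (fromℕ-* (r ℕ.+ 3) (s ℕ.* K))))))

      r≤hmTerm : fromℕ r ≤ hmTerm G (2 ℕ.+ r)
      r≤hmTerm = ℚₚ.≤-trans (ℚₚ.≤-reflexive r≡) (ℚₚ.+-monoʳ-≤ (fromℕ (2 ℕ.* (2 ℕ.+ r) ℕ.∸ 1)) (ℚₚ.neg-antimono-≤ b/a≤r+3))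
        where
        cross : ∀ r → 2 ℕ.* (2 ℕ.+ r) ≡ suc (r ℕ.+ (r ℕ.+ 3))
        cross = solve-∀
        r≡ : fromℕ r ≡ fromℕ (2 ℕ.* (2 ℕ.+ r) ℕ.∸ 1) - fromℕ (r ℕ.+ 3)
        r≡ = trans (sym (p+q-q≡p (fromℕ r) (fromℕ (r ℕ.+ 3))))
                   (cong (_- fromℕ (r ℕ.+ 3)) (trans (fromℕ-+ r (r ℕ.+ 3)) (cong (fromℕ ∘ (ℕ._∸ 1)) (sym (cross r)))))

      r<n∸δ∸1 : r ℕ.< (s ℕ.+ s) ℕ.∸ minDeg G ℕ.∸ 1
      r<n∸δ∸1 = begin-strict
        r                                <⟨ s≤s r≤R ⟩
        suc R                            ≤⟨ ℕₚ.m≤n+m (suc R) 4 ⟩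
        s ℕ.∸ 1                          ≡⟨ cong (ℕ._∸ 1) (sym (ℕₚ.m+n∸m≡n s s)) ⟩
        s ℕ.+ s ℕ.∸ s ℕ.∸ 1              ≤⟨ ℕₚ.∸-monoˡ-≤ 1 (ℕₚ.∸-monoʳ-≤ (s ℕ.+ s) δ≤s) ⟩
        s ℕ.+ s ℕ.∸ minDeg G ℕ.∸ 1       ∎
        where
        open ℕₚ.≤-Reasoning
        s<s+s : s ℕ.< s ℕ.+ s
        s<s+s = ℕₚ.m<m+n s (s≤s z≤n)
        δ≤s : minDeg G ℕ.≤ s
        δ≤s = ℕₚ.≤-trans (minDeg≤deg G (fromℕ< s<s+s))
                         (ℕₚ.≤-reflexive (deg-splitGraph-indep s s (fromℕ< s<s+s) (ℕₚ.≤-reflexive (sym (toℕ-fromℕ< s<s+s)))))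

      r≤αHM : fromℕ r ≤ αHM G
      r≤αHM = ℚₚ.≤-trans r≤hmTerm (hmTerm≤αHM G r r<n∸δ∸1)

  family : ℕ → ΓGraph
  family r = SplitFamily.Γ (r ℕ.* (r ℕ.+ 2))

  module _ (r : ℕ) where
    open SplitFamily (r ℕ.* (r ℕ.+ 2))

    r≤HM-family : fromℕ r ≤ HM (family r)
    r≤HM-family = r≤αHM {r} ℕₚ.≤-refl

    ACL<HM-family : 20 ℕ.< r → ACL (family r) < HM (family r)
    ACL<HM-family 20<r = ℚₚ.≤-<-trans αACL≤20 (ℚₚ.<-≤-trans (fromℕ-mono-< 20<r) r≤HM-family)

    HR<HM-family : 2 ℕ.< r → HR (family r) < HM (family r)
    HR<HM-family 2<r = ℚₚ.<-≤-trans (ℚₚ.≤-<-trans (fromℕ-mono-≤ αHR≤2) (fromℕ-mono-< 2<r)) r≤HM-family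

    1≤max-family : 1ℚ ≤ ACL (family r) ⊔ HR (family r) ⊔ S (family r)
    1≤max-family = ℚₚ.≤-trans (fromℕ-mono-≤ (1≤αHR G)) (ℚₚ.≤-trans (ℚₚ.p≤q⊔p (ACL (family r)) _) (ℚₚ.p≤p⊔q _ (S (family r))))

    max≤20-family : ACL (family r) ⊔ HR (family r) ⊔ S (family r) ≤ fromℕ 20
    max≤20-family = ℚₚ.⊔-lub (ℚₚ.⊔-lub αACL≤20 (fromℕ-mono-≤ (ℕₚ.≤-trans αHR≤2 (ℕₚ.m≤m+n 2 18))))
                             (ℚₚ.≤-trans αS≤3 (fromℕ-mono-≤ (ℕₚ.m≤m+n 3 17)))

  <-divQ-bounded : ∀ M {h q} → 1ℚ ≤ q → q ≤ fromℕ 20 → fromℕ (ℤ.∣ ℚ.↥ M ∣ ℕ.* 20) < h → M < divQ h q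
  <-divQ-bounded M {h} {q} 1≤q q≤20 c20<h = <-divQ (ℚₚ.<-≤-trans (fromℕ-mono-< {0} {1} (s≤s z≤n)) 1≤q) (begin-strict
    M * q                        ≤⟨ *-monoʳ-≤-0≤ 0≤q (≤-fromℕ-∣↥∣ M) ⟩
    fromℕ c * q                  ≤⟨ *-monoˡ-≤-0≤ (0≤/suc c 0) q≤20 ⟩
    fromℕ c * fromℕ 20           ≡⟨ fromℕ-* c 20 ⟩
    fromℕ (c ℕ.* 20)             <⟨ c20<h ⟩
    h                            ∎)
    where
    open ℚₚ.≤-Reasoning
    c : ℕ
    c = ℤ.∣ ℚ.↥ M ∣
    0≤q : 0ℚ ≤ q
    0≤q = ℚₚ.≤-trans (0≤/suc 1 0) 1≤q

  unbounded : Σ (ℕ → ΓGraph) λ Gs →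
            ∀ (M : ℚ) → ∃ λ (N : ℕ) → ∀ (m : ℕ) → N ℕ.≤ m →
              M < divQ (HM (Gs m)) (ACL (Gs m) ⊔ HR (Gs m) ⊔ S (Gs m))
  unbounded = family , λ M → suc (ℤ.∣ ℚ.↥ M ∣ ℕ.* 20) , λ m N≤m →
    <-divQ-bounded M (1≤max-family m) (max≤20-family m)
      (ℚₚ.<-≤-trans (fromℕ-mono-< N≤m) (r≤HM-family m))

open UnboundedRatio

module Examples where

  open import Data.Bool using (Bool; _∧_; _∨_; not)
  import Data.Bool.Properties as Boolₚ
  open import Data.Bool.ListAction using (any)
  open import Data.Nat as ℕ using (ℕ; _≡ᵇ_)
  import Data.Nat.Properties as ℕₚ
  open import Data.Fin using (Fin; toℕ; zero; suc)
  open import Data.List using (List; []; _∷_)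
  open import Data.Rational as ℚ using (ℚ; _<_)
  import Data.Rational.Properties as ℚₚ
  open import Data.Product using (Σ; _×_; _,_)
  open import Relation.Binary.PropositionalEquality
  open import Relation.Nullary.Decidable using (True; toWitness)

  decide-< : ∀ p q {p<q : True (p ℚₚ.<? q)} → p < q
  decide-< p q {p<q} = toWitness p<q

  fromEdges : ∀ n → List (ℕ × ℕ) → Graph n
  fromEdges n es = record
    { adj    = λ u v → (listed (toℕ u) (toℕ v) ∨ listed (toℕ v) (toℕ u)) ∧ not (toℕ u ≡ᵇ toℕ v)
    ; sym    = λ u v → cong₂ (λ x y → x ∧ not y) (Boolₚ.∨-comm (listed (toℕ u) (toℕ v)) _) (≡ᵇ-sym (toℕ u) (toℕ v))
    ; irrefl = λ u → trans (cong (λ y → (listed (toℕ u) (toℕ u) ∨ listed (toℕ u) (toℕ u)) ∧ not y) (≡ᵇ-refl (toℕ u)))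
                            (Boolₚ.∧-zeroʳ _)
    }
    where
    listed : ℕ → ℕ → Bool
    listed i j = any (λ { (a , b) → (a ≡ᵇ i) ∧ (b ≡ᵇ j) }) es

  P₃ : ΓGraph
  P₃ = record
    { graph       = fromEdges 3 ((0 , 1) ∷ (0 , 2) ∷ [])
    ; connected   = connected-viaHub _ zero λ { zero → nil ; (suc zero) → cons refl nil ; (suc (suc zero)) → cons refl nil }
    ; nonComplete = suc zero , suc (suc zero) , (λ ()) , refl
    }

  K₁,₃ : ΓGraph
  K₁,₃ = record
    { graph       = fromEdges 4 ((0 , 1) ∷ (0 , 2) ∷ (0 , 3) ∷ [])
    ; connected   = connected-viaHub _ zero λ { zero → nil ; (suc zero) → cons refl nil ; (suc (suc zero)) → cons refl nil
                                              ; (suc (suc (suc zero))) → cons refl nil }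
    ; nonComplete = suc zero , suc (suc zero) , (λ ()) , refl
    }

  K₁,₄ : ΓGraph
  K₁,₄ = record
    { graph       = fromEdges 5 ((0 , 1) ∷ (0 , 2) ∷ (0 , 3) ∷ (0 , 4) ∷ [])
    ; connected   = connected-viaHub _ zero λ { zero → nil ; (suc zero) → cons refl nil ; (suc (suc zero)) → cons refl nil
                                              ; (suc (suc (suc zero))) → cons refl nil ; (suc (suc (suc (suc zero)))) → cons refl nil }
    ; nonComplete = suc zero , suc (suc zero) , (λ ()) , refl
    }

  T₅ : ΓGraph
  T₅ = record
    { graph       = fromEdges 5 ((0 , 1) ∷ (0 , 3) ∷ (0 , 4) ∷ (1 , 2) ∷ [])
    ; connected   = connected-viaHub _ zero λ { zero → nil ; (suc zero) → cons refl nil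
                                              ; (suc (suc zero)) → cons {w = suc zero} refl (cons refl nil)
                                              ; (suc (suc (suc zero))) → cons refl nil ; (suc (suc (suc (suc zero)))) → cons refl nil }
    ; nonComplete = suc zero , suc (suc (suc zero)) , (λ ()) , refl
    }

  G₇ : ΓGraph
  G₇ = record
    { graph       = fromEdges 7 ((0 , 3) ∷ (1 , 4) ∷ (1 , 5) ∷ (1 , 6) ∷ (2 , 3) ∷ (2 , 4) ∷ (3 , 4) ∷ (4 , 6) ∷ [])
    ; connected   = connected-viaHub _ v₄ λ
        { zero                                     → cons {w = suc (suc (suc zero))} refl (cons refl nil)
        ; (suc zero)                               → cons refl nil
        ; (suc (suc zero))                         → cons refl nil
        ; (suc (suc (suc zero)))                   → cons refl nil
        ; (suc (suc (suc (suc zero))))             → nil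
        ; (suc (suc (suc (suc (suc zero)))))       → cons {w = suc zero} refl (cons refl nil)
        ; (suc (suc (suc (suc (suc (suc zero)))))) → cons refl nil
        }
    ; nonComplete = zero , suc zero , (λ ()) , refl
    }
    where
    v₄ : Fin 7
    v₄ = suc (suc (suc (suc zero)))

  Separated : (ΓGraph → ℚ) → (ΓGraph → ℚ) → Set
  Separated f g = Σ ΓGraph λ G₁ → Σ ΓGraph λ G₂ → (f G₁ < g G₁) × (g G₂ < f G₂)

  Separated-sym : ∀ {f g} → Separated f g → Separated g f
  Separated-sym (G₁ , G₂ , f<g , g<f) = G₂ , G₁ , g<f , f<g

  ACL-S : Separated ACL S
  ACL-S = G₇ , P₃ , decide-< _ _ , decide-< _ _

  ACL-HR : Separated ACL HR
  ACL-HR = T₅ , K₁,₃ , decide-< _ _ , decide-< _ _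

  ACL-HM : Separated ACL HM
  ACL-HM = family 21 , K₁,₃ , ACL<HM-family 21 ℕₚ.≤-refl , decide-< _ _

  S-HR : Separated S HR
  S-HR = P₃ , K₁,₃ , decide-< _ _ , decide-< _ _

  S-HM : Separated S HM
  S-HM = P₃ , K₁,₃ , decide-< _ _ , decide-< _ _

  HR-HM : Separated HR HM
  HR-HM = family 3 , K₁,₄ , HR<HM-family 3 ℕₚ.≤-refl , decide-< _ _

open Examples

open import Data.Nat as ℕ using (ℕ)
open import Data.Fin using (Fin)
open import Data.Fin.Patterns using (0F; 1F; 2F; 3F)
open import Data.Rational as ℚ using (ℚ; _<_; _⊔_)
open import Data.Product using (Σ; _×_; ∃; _,_)
open import Relation.Binary.PropositionalEquality using (_≢_; refl)
open import Data.Empty using (⊥-elim)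

-- The diagonal cases use ⊥-elim: with an absurd with-pattern instead, checking
-- this definition exhausts memory.
separated : (i j : Fin 4) → i ≢ j → Separated (αFun i) (αFun j)
separated 0F 0F i≢j = ⊥-elim (i≢j refl)
separated 0F 1F _   = ACL-S
separated 0F 2F _   = ACL-HR
separated 0F 3F _   = ACL-HM
separated 1F 0F _   = Separated-sym ACL-S
separated 1F 1F i≢j = ⊥-elim (i≢j refl)
separated 1F 2F _   = S-HR
separated 1F 3F _   = S-HM
separated 2F 0F _   = Separated-sym ACL-HR
separated 2F 1F _   = Separated-sym S-HR
separated 2F 2F i≢j = ⊥-elim (i≢j refl)
separated 2F 3F _   = HR-HM
separated 3F 0F _   = Separated-sym ACL-HM
separated 3F 1F _   = Separated-sym S-HM
separated 3F 2F _   = Separated-sym HR-HM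
separated 3F 3F i≢j = ⊥-elim (i≢j refl)

theorem5 :
    ((i j : Fin 4) → i ≢ j →
      Σ ΓGraph λ G₁ → Σ ΓGraph λ G₂ →
        (αFun i G₁ < αFun j G₁) × (αFun j G₂ < αFun i G₂))
    ×
    (Σ (ℕ → ΓGraph) λ Gs →
      ∀ (M : ℚ) → ∃ λ (N : ℕ) → ∀ (m : ℕ) → N ℕ.≤ m →
        M < divQ (HM (Gs m)) (ACL (Gs m) ⊔ HR (Gs m) ⊔ S (Gs m)))
theorem5 = separated , unbounded
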